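{- For every nonnegative integer $\ell$, every nonnegative integer $n$ and every complex number $x$, $${}_3F_2\left[\begin{matrix} 3x,\ 1-\ell-3x,\ -n\\ \tfrac12,\ -3n\end{matrix}\middle|\frac34\right]=\left[\begin{matrix} 3x\\ 6x\end{matrix}\right]_\ell\sum_{i=0}^{\ell}(-1)^i\,\frac{6x+2i-1}{6x-1}\left[\begin{matrix} -\ell,\ 6x-1\\ 1,\ 6x+\ell\end{matrix}\right]_i\left[\begin{matrix} \frac{1+i}{3}+x,\ \frac{2-i}{3}-x\\ \frac13,\ \frac23\end{matrix}\right]_n.$$
   Context: For a complex number $a$ and a nonnegative integer $m$, $(a)_m=a(a+1)\cdots(a+m-1)$ with $(a)_0=1$. The bracket notation means $\left[\begin{matrix} a_1,\dots,a_r\\ b_1,\dots,b_s\end{matrix}\right]_m=\frac{(a_1)_m\cdots(a_r)_m}{(b_1)_m\cdots(b_s)_m}$. For a nonnegative integer $n$, the terminating series is ${}_3F_2\left[\begin{matrix} a,\ b,\ -n\\ d,\ e\end{matrix}\middle|z\right]=\sum_{k=0}^{n}\frac{(a)_k(b)_k(-n)_k}{k!\,(d)_k(e)_k}z^k$. The identity is understood for values of $x$ for which no denominator vanishes. -}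

module Defs where

open import Level using (_⊔_)
open import Data.Nat as ℕ using (ℕ; zero; suc)
open import Algebra.Bundles using (CommutativeRing)
open import Relation.Nullary using (¬_)

natEmb : ∀ {c ℓ} (R : CommutativeRing c ℓ) → ℕ → CommutativeRing.Carrier R
natEmb R zero    = CommutativeRing.0# R
natEmb R (suc n) = CommutativeRing._+_ R (CommutativeRing.1# R) (natEmb R n)

-- A field of characteristic zero (the complex numbers are an instance).
-- The inverse is total; only its value on nonzero elements is constrained.
record CharZeroField c ℓ : Set (Level.suc (c ⊔ ℓ)) where
  field
    commutativeRing : CommutativeRing c ℓ
  open CommutativeRing commutativeRing public
  field
    _⁻¹       : Carrier → Carrier
    ⁻¹-cong   : ∀ {x y} → x ≈ y → x ⁻¹ ≈ y ⁻¹
    inverse   : ∀ x → ¬ (x ≈ 0#) → x * (x ⁻¹) ≈ 1#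
    char-zero : ∀ n → ¬ (natEmb commutativeRing (suc n) ≈ 0#)
  ι : ℕ → Carrier
  ι = natEmb commutativeRing

module FieldOps {c ℓ} (F : CharZeroField c ℓ) where
  open CharZeroField F

  infixl 7 _÷_
  _÷_ : Carrier → Carrier → Carrier
  a ÷ b = a * (b ⁻¹)

  pow : Carrier → ℕ → Carrier
  pow z zero    = 1#
  pow z (suc k) = pow z k * z

  poch : Carrier → ℕ → Carrier
  poch a zero    = 1#
  poch a (suc m) = poch a m * (a + ι m)

  sumTo : ℕ → (ℕ → Carrier) → Carrier
  sumTo zero    f = f 0
  sumTo (suc n) f = sumTo n f + f (suc n)

  ₃F₂ : Carrier → Carrier → ℕ → Carrier → Carrier → Carrier → Carrier
  ₃F₂ a b n d e z =
    sumTo n (λ k → (poch a k * poch b k * poch (- ι n) k)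
                   ÷ (poch 1# k * poch d k * poch e k) * pow z k)

-- Write u = 3x and t = 6x = 2u. For l = 0 the identity is the evaluation
--   ₃F₂[w, 1-w, -n; 1/2, -3n | 3/4] = ((w+1)/3)ₙ ((2-w)/3)ₙ / ((1/3)ₙ (2/3)ₙ)   (w = u),
-- proved by induction on n: with d = (3n+1)(3n+2), both sides satisfy d Xₙ₊₁ = (d + w(1-w)) Xₙ;
-- for the series this follows from a three-term recurrence of its coefficients in n.
-- For the induction on l, the contiguous relation (a-b) F(a,b) = a F(a+1,b) - b F(a,b+1) gives
--   (t+l) L_{l+1}(u) = (u+l) L_l(u) + u L_l(u+1)
-- for the left-hand side L_l(u). The right-hand side, a weighted sum of the l = 0 values at u+i,
-- satisfies the same recurrence term by term: its weights obey a Pascal-type rule which, after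
-- factoring out a common term, is the identity (l+1)(t+l) = (l-j)(t+l+j+1) + (t+j)(j+1).
-- The hypotheses of the theorem amount to t ≠ 1 and t + m ≠ 0 for m < 2l, which is exactly what
-- this induction needs.

module Submission where

open import Defs
open import Data.Nat using (ℕ; zero; suc; _≤_; _<_; z≤n; s≤s)
import Data.Nat as ℕ
import Data.Nat.Properties as ℕₚ
open import Data.Integer as ℤ using (ℤ; +_; -[1+_])
import Data.Integer.Properties as ℤₚ
import Data.Sign as Sign
open import Data.Maybe using (Maybe; just; nothing)
open import Data.Sum using (inj₁; inj₂)
open import Function using (_∘_)
open import Relation.Nullary using (¬_; yes; no)
open import Relation.Binary.PropositionalEquality as ≡ using (_≡_)
open import Algebra.Solver.Ring.AlmostCommutativeRing
  using (fromCommutativeRing; _-Raw-AlmostCommutative⟶_)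

module IntegerSolver {c ℓ} (F : CharZeroField c ℓ) where
  open CharZeroField F
  open import Algebra.Properties.Ring ring
    using (-‿distribˡ-*; -‿distribʳ-*; -‿involutive; -0#≈0#; -‿+-comm)
  open import Relation.Binary.Reasoning.Setoid setoid

  ι-+ : ∀ m n → ι (m ℕ.+ n) ≈ ι m + ι n
  ι-+ zero    n = sym (+-identityˡ _)
  ι-+ (suc m) n = trans (+-congˡ (ι-+ m n)) (sym (+-assoc _ _ _))

  ι-* : ∀ m n → ι (m ℕ.* n) ≈ ι m * ι n
  ι-* zero    n = sym (zeroˡ _)
  ι-* (suc m) n = begin
    ι (n ℕ.+ m ℕ.* n)        ≈⟨ ι-+ n (m ℕ.* n) ⟩
    ι n + ι (m ℕ.* n)        ≈⟨ +-cong (sym (*-identityˡ _)) (ι-* m n) ⟩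
    1# * ι n + ι m * ι n     ≈⟨ sym (distribʳ _ _ _) ⟩
    (1# + ι m) * ι n         ∎

  ⟦_⟧ᶻ : ℤ → Carrier
  ⟦ + n ⟧ᶻ      = ι n
  ⟦ -[1+ n ] ⟧ᶻ = - ι (suc n)

  sub-cancel-1 : ∀ a b → (1# + a) - (1# + b) ≈ a - b
  sub-cancel-1 a b = begin
    (1# + a) + - (1# + b)    ≈⟨ +-congˡ (sym (-‿+-comm 1# b)) ⟩
    (1# + a) + (- 1# + - b)  ≈⟨ +-assoc 1# a _ ⟩
    1# + (a + (- 1# + - b))  ≈⟨ +-congˡ (trans (sym (+-assoc a _ _)) (trans (+-congʳ (+-comm a _)) (+-assoc _ _ _))) ⟩
    1# + (- 1# + (a - b))    ≈⟨ sym (+-assoc _ _ _) ⟩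
    (1# - 1#) + (a - b)      ≈⟨ +-congʳ (-‿inverseʳ 1#) ⟩
    0# + (a - b)             ≈⟨ +-identityˡ _ ⟩
    a - b                    ∎

  ⊖-homo : ∀ m n → ⟦ m ℤ.⊖ n ⟧ᶻ ≈ ι m - ι n
  ⊖-homo m       zero    = sym (trans (+-congˡ -0#≈0#) (+-identityʳ _))
  ⊖-homo zero    (suc n) = sym (+-identityˡ _)
  ⊖-homo (suc m) (suc n) rewrite ℤₚ.[1+m]⊖[1+n]≡m⊖n m n =
    trans (⊖-homo m n) (sym (sub-cancel-1 (ι m) (ι n)))

  +◃-homo : ∀ n → ⟦ Sign.+ ℤ.◃ n ⟧ᶻ ≈ ι n
  +◃-homo zero    = refl
  +◃-homo (suc n) = refl

  -◃-homo : ∀ n → ⟦ Sign.- ℤ.◃ n ⟧ᶻ ≈ - ι n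
  -◃-homo zero    = sym -0#≈0#
  -◃-homo (suc n) = refl

  +-homo : ∀ i j → ⟦ i ℤ.+ j ⟧ᶻ ≈ ⟦ i ⟧ᶻ + ⟦ j ⟧ᶻ
  +-homo (+ m)    (+ n)    = ι-+ m n
  +-homo (+ m)    -[1+ n ] = ⊖-homo m (suc n)
  +-homo -[1+ m ] (+ n)    = trans (⊖-homo n (suc m)) (+-comm _ _)
  +-homo -[1+ m ] -[1+ n ] = begin
    - ι (suc (suc (m ℕ.+ n)))  ≈⟨ -‿cong (reflexive (≡.cong ι (≡.cong suc (≡.sym (ℕₚ.+-suc m n))))) ⟩
    - ι (suc m ℕ.+ suc n)      ≈⟨ -‿cong (ι-+ (suc m) (suc n)) ⟩
    - (ι (suc m) + ι (suc n))  ≈⟨ sym (-‿+-comm _ _) ⟩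
    - ι (suc m) + - ι (suc n)  ∎

  *-homo : ∀ i j → ⟦ i ℤ.* j ⟧ᶻ ≈ ⟦ i ⟧ᶻ * ⟦ j ⟧ᶻ
  *-homo (+ m)    (+ n)    = trans (+◃-homo (m ℕ.* n)) (ι-* m n)
  *-homo (+ m)    -[1+ n ] = trans (-◃-homo (m ℕ.* suc n)) (trans (-‿cong (ι-* m (suc n))) (-‿distribʳ-* _ _))
  *-homo -[1+ m ] (+ n)    = trans (-◃-homo (suc m ℕ.* n)) (trans (-‿cong (ι-* (suc m) n)) (-‿distribˡ-* _ _))
  *-homo -[1+ m ] -[1+ n ] = begin
    ⟦ Sign.+ ℤ.◃ (suc m ℕ.* suc n) ⟧ᶻ  ≈⟨ +◃-homo (suc m ℕ.* suc n) ⟩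
    ι (suc m ℕ.* suc n)               ≈⟨ ι-* (suc m) (suc n) ⟩
    ι (suc m) * ι (suc n)             ≈⟨ sym (-‿involutive _) ⟩
    - - (ι (suc m) * ι (suc n))       ≈⟨ -‿cong (-‿distribʳ-* _ _) ⟩
    - (ι (suc m) * - ι (suc n))       ≈⟨ -‿distribˡ-* _ _ ⟩
    - ι (suc m) * - ι (suc n)         ∎

  -‿homo : ∀ i → ⟦ ℤ.- i ⟧ᶻ ≈ - ⟦ i ⟧ᶻ
  -‿homo (+ zero)  = sym -0#≈0#
  -‿homo (+ suc n) = refl
  -‿homo -[1+ n ]  = sym (-‿involutive _)

  ⟦⟧-homomorphism : ℤ.+-*-rawRing -Raw-AlmostCommutative⟶ fromCommutativeRing commutativeRing
  ⟦⟧-homomorphism = record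
    { ⟦_⟧ = ⟦_⟧ᶻ ; +-homo = +-homo ; *-homo = *-homo ; -‿homo = -‿homo
    ; 0-homo = refl ; 1-homo = +-identityʳ 1# }

  ⟦⟧-≟ : ∀ i j → Maybe (⟦ i ⟧ᶻ ≈ ⟦ j ⟧ᶻ)
  ⟦⟧-≟ i j with i ℤ.≟ j
  ... | yes ≡.refl = just refl
  ... | no _       = nothing

  open import Algebra.Solver.Ring ℤ.+-*-rawRing (fromCommutativeRing commutativeRing) ⟦⟧-homomorphism ⟦⟧-≟ public
    using (Polynomial; solve; _:=_; con; _:+_; _:*_; _:-_; :-_; _:^_)

  -- Denotes 1# itself, whereas con (+ 1) denotes ι 1 = 1# + 0#.
  :1 : ∀ {n} → Polynomial n
  :1 = con (+ 0) :^ 0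

module FieldFacts {c ℓ} (F : CharZeroField c ℓ) where
  open CharZeroField F
  open FieldOps F
  open IntegerSolver F
  open import Algebra.Properties.Ring ring using (-‿involutive; -0#≈0#)
  open import Algebra.Properties.CommutativeSemigroup *-commutativeSemigroup using (x∙yz≈y∙xz)
  open import Relation.Binary.Reasoning.Setoid setoid

  1≉0 : 1# ≉ 0#
  1≉0 1≈0 = char-zero 0 (trans (+-identityʳ 1#) 1≈0)

  ι-suc≉0 : ∀ n → ι (suc n) ≉ 0#
  ι-suc≉0 = char-zero

  ≈ι-suc⇒≉0 : ∀ {x} m → x ≈ ι (suc m) → x ≉ 0#
  ≈ι-suc⇒≉0 m x≈ι x≈0 = ι-suc≉0 m (trans (sym x≈ι) x≈0)

  ⁻¹-*-cancel : ∀ {z} a → z ≉ 0# → z ⁻¹ * (z * a) ≈ a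
  ⁻¹-*-cancel {z} a z≉0 = begin
    z ⁻¹ * (z * a)  ≈⟨ solve 3 (λ z w a → w :* (z :* a) := (z :* w) :* a) refl z (z ⁻¹) a ⟩
    (z * z ⁻¹) * a  ≈⟨ *-congʳ (inverse z z≉0) ⟩
    1# * a          ≈⟨ *-identityˡ a ⟩
    a               ∎

  *-cancelˡ : ∀ {z a b} → z ≉ 0# → z * a ≈ z * b → a ≈ b
  *-cancelˡ {z} {a} {b} z≉0 za≈zb = begin
    a               ≈⟨ sym (⁻¹-*-cancel a z≉0) ⟩
    z ⁻¹ * (z * a)  ≈⟨ *-congˡ za≈zb ⟩
    z ⁻¹ * (z * b)  ≈⟨ ⁻¹-*-cancel b z≉0 ⟩
    b               ∎

  *-≉0 : ∀ {x y} → x ≉ 0# → y ≉ 0# → x * y ≉ 0#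
  *-≉0 {x} {y} x≉0 y≉0 xy≈0 = y≉0 (*-cancelˡ x≉0 (trans xy≈0 (sym (zeroʳ x))))

  ≉0-factorˡ : ∀ {x y z} → z ≈ x * y → z ≉ 0# → x ≉ 0#
  ≉0-factorˡ {x} {y} z≈xy z≉0 x≈0 = z≉0 (trans z≈xy (trans (*-congʳ x≈0) (zeroˡ y)))

  -‿≉0 : ∀ {x} → x ≉ 0# → - x ≉ 0#
  -‿≉0 {x} x≉0 -x≈0 = x≉0 (trans (sym (-‿involutive x)) (trans (-‿cong -x≈0) -0#≈0#))

  -ι+ι≉0 : ∀ {m j} → j < m → - ι m + ι j ≉ 0#
  -ι+ι≉0 {m} {j} j<m = ≉0-factorˡ {y = - 1#} (begin
    ι (suc e)
      ≈⟨ solve 2 (λ j e → :1 :+ e := (:- (:1 :+ (j :+ e)) :+ j) :* (:- :1)) refl (ι j) (ι e) ⟩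
    (- (1# + (ι j + ι e)) + ι j) * - 1#
      ≈⟨ *-congʳ (+-congʳ (-‿cong (+-congˡ (sym (ι-+ j e))))) ⟩
    (- ι (suc j ℕ.+ e) + ι j) * - 1#
      ≈⟨ *-congʳ (+-congʳ (-‿cong (reflexive (≡.cong ι (ℕₚ.m+[n∸m]≡n j<m))))) ⟩
    (- ι m + ι j) * - 1#   ∎) (ι-suc≉0 e)
    where
    e : ℕ
    e = m ℕ.∸ suc j

  ÷-cong : ∀ {a a′ b b′} → a ≈ a′ → b ≈ b′ → a ÷ b ≈ a′ ÷ b′
  ÷-cong a≈a′ b≈b′ = *-cong a≈a′ (⁻¹-cong b≈b′)

  ÷-*-cancel : ∀ a {b} → b ≉ 0# → a ÷ b * b ≈ a
  ÷-*-cancel a {b} b≉0 = begin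
    a * b ⁻¹ * b    ≈⟨ solve 3 (λ a b w → a :* w :* b := a :* (b :* w)) refl a b (b ⁻¹) ⟩
    a * (b * b ⁻¹)  ≈⟨ *-congˡ (inverse b b≉0) ⟩
    a * 1#          ≈⟨ *-identityʳ a ⟩
    a               ∎

  ÷-self : ∀ {a} → a ≉ 0# → a ÷ a ≈ 1#
  ÷-self {a} = inverse a

  ÷-unique : ∀ {x a b} → b ≉ 0# → x * b ≈ a → x ≈ a ÷ b
  ÷-unique {x} {a} {b} b≉0 xb≈a = *-cancelˡ b≉0 (begin
    b * x            ≈⟨ *-comm b x ⟩
    x * b            ≈⟨ xb≈a ⟩
    a                ≈⟨ sym (÷-*-cancel a b≉0) ⟩
    a ÷ b * b        ≈⟨ *-comm _ b ⟩
    b * (a ÷ b)      ∎)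

  ⁻¹-* : ∀ {a b} → a ≉ 0# → b ≉ 0# → (a * b) ⁻¹ ≈ a ⁻¹ * b ⁻¹
  ⁻¹-* {a} {b} a≉0 b≉0 = sym (trans (÷-unique (*-≉0 a≉0 b≉0) (begin
    (a ⁻¹ * b ⁻¹) * (a * b)      ≈⟨ solve 4 (λ a b x y → (x :* y) :* (a :* b) := (a :* x) :* (b :* y)) refl a b (a ⁻¹) (b ⁻¹) ⟩
    (a * a ⁻¹) * (b * b ⁻¹)      ≈⟨ *-cong (inverse a a≉0) (inverse b b≉0) ⟩
    1# * 1#                      ≈⟨ *-identityˡ 1# ⟩
    1#                           ∎)) (*-identityˡ _))

  ÷-*-÷ : ∀ {a b c d} → b ≉ 0# → d ≉ 0# → (a ÷ b) * (c ÷ d) ≈ (a * c) ÷ (b * d)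
  ÷-*-÷ {a} {b} {c} {d} b≉0 d≉0 = begin
    (a * b ⁻¹) * (c * d ⁻¹)  ≈⟨ solve 4 (λ a x c y → (a :* x) :* (c :* y) := (a :* c) :* (x :* y)) refl a (b ⁻¹) c (d ⁻¹) ⟩
    (a * c) * (b ⁻¹ * d ⁻¹)  ≈⟨ *-congˡ (sym (⁻¹-* b≉0 d≉0)) ⟩
    (a * c) ÷ (b * d)        ∎

  ÷-cross : ∀ {a b c d} → b ≉ 0# → d ≉ 0# → a * d ≈ c * b → a ÷ b ≈ c ÷ d
  ÷-cross {a} {b} {c} {d} b≉0 d≉0 ad≈cb = ÷-unique d≉0 (begin
    a ÷ b * d        ≈⟨ solve 3 (λ a w d → a :* w :* d := a :* d :* w) refl a (b ⁻¹) d ⟩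
    a * d ÷ b        ≈⟨ *-congʳ ad≈cb ⟩
    c * b ÷ b        ≈⟨ *-assoc c b _ ⟩
    c * (b ÷ b)      ≈⟨ *-congˡ (÷-self b≉0) ⟩
    c * 1#           ≈⟨ *-identityʳ c ⟩
    c                ∎)

  ÷-step : ∀ {N D ν δ} → D ≉ 0# → δ ≉ 0# → (N * ν) ÷ (D * δ) * δ ≈ (N ÷ D) * ν
  ÷-step {N} {D} {ν} {δ} D≉0 δ≉0 = begin
    (N * ν) * (D * δ) ⁻¹ * δ
      ≈⟨ *-congʳ (*-congˡ (⁻¹-* D≉0 δ≉0)) ⟩
    (N * ν) * (D ⁻¹ * δ ⁻¹) * δ
      ≈⟨ solve 5 (λ N ν x δ y → (N :* ν) :* (x :* y) :* δ := (N :* x) :* ν :* (δ :* y)) refl N ν (D ⁻¹) δ (δ ⁻¹) ⟩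
    (N ÷ D) * ν * (δ * δ ⁻¹)
      ≈⟨ *-congˡ (inverse δ δ≉0) ⟩
    (N ÷ D) * ν * 1#
      ≈⟨ *-identityʳ _ ⟩
    (N ÷ D) * ν   ∎

  +-*-÷ : ∀ a b {c} → c ≉ 0# → (a + c * b) ÷ c ≈ a ÷ c + b
  +-*-÷ a b {c} c≉0 = sym (÷-unique c≉0 (begin
    (a ÷ c + b) * c      ≈⟨ distribʳ c _ b ⟩
    a ÷ c * c + b * c    ≈⟨ +-cong (÷-*-cancel a c≉0) (*-comm b c) ⟩
    a + c * b            ∎))

  fraction+ι≉0 : ∀ {x} a b j → x ≈ ι (suc a) → x ÷ ι (suc b) + ι j ≉ 0#
  fraction+ι≉0 {x} a b j x≈ι = ≉0-factorˡ {y = ι (suc b)} (begin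
    ι (suc a ℕ.+ suc b ℕ.* j)                 ≈⟨ trans (ι-+ (suc a) _) (+-congˡ (ι-* (suc b) j)) ⟩
    ι (suc a) + ι (suc b) * ι j               ≈⟨ +-congʳ (sym x≈ι) ⟩
    x + ι (suc b) * ι j                       ≈⟨ sym (÷-*-cancel _ (ι-suc≉0 b)) ⟩
    (x + ι (suc b) * ι j) ÷ ι (suc b) * ι (suc b)  ≈⟨ *-congʳ (+-*-÷ x (ι j) (ι-suc≉0 b)) ⟩
    (x ÷ ι (suc b) + ι j) * ι (suc b)              ∎) (ι-suc≉0 (a ℕ.+ suc b ℕ.* j))

  *-÷-+ : ∀ x y {c} → c ≉ 0# → c * (x ÷ c + y) ≈ x + c * y
  *-÷-+ x y {c} c≉0 = begin
    c * (x ÷ c + y)          ≈⟨ *-congˡ (sym (+-*-÷ x y c≉0)) ⟩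
    c * ((x + c * y) ÷ c)    ≈⟨ *-comm c _ ⟩
    (x + c * y) ÷ c * c      ≈⟨ ÷-*-cancel _ c≉0 ⟩
    x + c * y                ∎

  *-rescale : ∀ {x y a b a′ b′} c → x * a ≈ y * b → c * a ≈ a′ → c * b ≈ b′ → x * a′ ≈ y * b′
  *-rescale {x} {y} {a} {b} {a′} {b′} c xa≈yb ca≈a′ cb≈b′ = begin
    x * a′         ≈⟨ *-congˡ (sym ca≈a′) ⟩
    x * (c * a)    ≈⟨ x∙yz≈y∙xz x c a ⟩
    c * (x * a)    ≈⟨ *-congˡ xa≈yb ⟩
    c * (y * b)    ≈⟨ x∙yz≈y∙xz c y b ⟩
    y * (c * b)    ≈⟨ *-congˡ cb≈b′ ⟩
    y * b′         ∎

  *-cancel-common : ∀ {x y a b c} → c ≉ 0# → x * (c * a) ≈ y * (c * b) → x * a ≈ y * b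
  *-cancel-common {x} {y} {a} {b} {c} c≉0 eq = *-cancelˡ c≉0 (begin
    c * (x * a)    ≈⟨ x∙yz≈y∙xz c x a ⟩
    x * (c * a)    ≈⟨ eq ⟩
    y * (c * b)    ≈⟨ x∙yz≈y∙xz y c b ⟩
    c * (y * b)    ∎)

module Pochhammer {c ℓ} (F : CharZeroField c ℓ) where
  open CharZeroField F
  open FieldOps F
  open IntegerSolver F
  open FieldFacts F
  open import Relation.Binary.Reasoning.Setoid setoid

  poch-cong : ∀ {a b} k → a ≈ b → poch a k ≈ poch b k
  poch-cong zero    a≈b = refl
  poch-cong (suc k) a≈b = *-cong (poch-cong k a≈b) (+-congʳ a≈b)

  poch-sucˡ : ∀ a k → poch a (suc k) ≈ a * poch (a + 1#) k
  poch-sucˡ a zero    = solve 1 (λ a → :1 :* (a :+ con (+ 0)) := a :* :1) refl a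
  poch-sucˡ a (suc k) = begin
    poch a (suc k) * (a + ι (suc k))
      ≈⟨ *-congʳ (poch-sucˡ a k) ⟩
    a * poch (a + 1#) k * (a + (1# + ι k))
      ≈⟨ solve 3 (λ a p k → a :* p :* (a :+ (:1 :+ k)) := a :* (p :* ((a :+ :1) :+ k))) refl a (poch (a + 1#) k) (ι k) ⟩
    a * (poch (a + 1#) k * ((a + 1#) + ι k))   ∎

  poch-+ : ∀ a m k → poch a (m ℕ.+ k) ≈ poch a m * poch (a + ι m) k
  poch-+ a m zero    = trans (reflexive (≡.cong (poch a) (ℕₚ.+-identityʳ m))) (sym (*-identityʳ _))
  poch-+ a m (suc k) = begin
    poch a (m ℕ.+ suc k)                                ≡⟨ ≡.cong (poch a) (ℕₚ.+-suc m k) ⟩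
    poch a (m ℕ.+ k) * (a + ι (m ℕ.+ k))                ≈⟨ *-cong (poch-+ a m k) (+-congˡ (ι-+ m k)) ⟩
    poch a m * poch (a + ι m) k * (a + (ι m + ι k))     ≈⟨ *-assoc _ _ _ ⟩
    poch a m * (poch (a + ι m) k * (a + (ι m + ι k)))   ≈⟨ *-congˡ (*-congˡ (sym (+-assoc a _ _))) ⟩
    poch a m * poch (a + ι m) (suc k)                   ∎

  poch-≉0 : ∀ {a} k → (∀ j → j < k → a + ι j ≉ 0#) → poch a k ≉ 0#
  poch-≉0 zero    factors≉0 = 1≉0
  poch-≉0 (suc k) factors≉0 =
    *-≉0 (poch-≉0 k (λ j j<k → factors≉0 j (ℕₚ.m<n⇒m<1+n j<k))) (factors≉0 k ℕₚ.≤-refl)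

  poch-1≉0 : ∀ k → poch 1# k ≉ 0#
  poch-1≉0 k = poch-≉0 k (λ j _ → ι-suc≉0 j)

  poch-≈0 : ∀ {a j} k → j < k → a + ι j ≈ 0# → poch a k ≈ 0#
  poch-≈0 {a} {j} (suc k) (s≤s j≤k) factor≈0 with ℕₚ.m≤n⇒m<n∨m≡n j≤k
  ... | inj₁ j<k    = trans (*-congʳ (poch-≈0 k j<k factor≈0)) (zeroˡ _)
  ... | inj₂ ≡.refl = trans (*-congˡ factor≈0) (zeroʳ _)

  poch-contiguous : ∀ a b k →
    (a - b) * (poch a k * poch b k) ≈ a * (poch (a + 1#) k * poch b k) + (- b) * (poch a k * poch (b + 1#) k)
  poch-contiguous a b k = begin
    (a - b) * (poch a k * poch b k)
      ≈⟨ solve 5 (λ a b k p q →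
             (a :- b) :* (p :* q)
          := (p :* (a :+ k)) :* q :+ :- (q :* (b :+ k)) :* p)
          refl a b (ι k) (poch a k) (poch b k) ⟩
    poch a (suc k) * poch b k + - poch b (suc k) * poch a k
      ≈⟨ +-cong (*-congʳ (poch-sucˡ a k)) (*-congʳ (-‿cong (poch-sucˡ b k))) ⟩
    a * poch (a + 1#) k * poch b k + - (b * poch (b + 1#) k) * poch a k
      ≈⟨ solve 6 (λ a b p q r s →
             a :* p :* q :+ :- (b :* r) :* s
          := a :* (p :* q) :+ (:- b) :* (s :* r))
          refl a b (poch (a + 1#) k) (poch b k) (poch (b + 1#) k) (poch a k) ⟩
    a * (poch (a + 1#) k * poch b k) + (- b) * (poch a k * poch (b + 1#) k)   ∎

module Sums {c ℓ} (F : CharZeroField c ℓ) where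
  open CharZeroField F
  open FieldOps F
  open IntegerSolver F
  open import Relation.Binary.Reasoning.Setoid setoid

  sumTo-cong : ∀ n {f g} → (∀ k → k ≤ n → f k ≈ g k) → sumTo n f ≈ sumTo n g
  sumTo-cong zero    f≈g = f≈g 0 z≤n
  sumTo-cong (suc n) f≈g = +-cong (sumTo-cong n (λ k k≤n → f≈g k (ℕₚ.m≤n⇒m≤1+n k≤n))) (f≈g (suc n) ℕₚ.≤-refl)

  sumTo-+ : ∀ n f g → sumTo n (λ k → f k + g k) ≈ sumTo n f + sumTo n g
  sumTo-+ zero    f g = refl
  sumTo-+ (suc n) f g = trans (+-congʳ (sumTo-+ n f g))
    (solve 4 (λ a b c d → (a :+ b) :+ (c :+ d) := (a :+ c) :+ (b :+ d)) refl _ _ _ _)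

  sumTo-*ˡ : ∀ n x f → x * sumTo n f ≈ sumTo n (λ k → x * f k)
  sumTo-*ˡ zero    x f = refl
  sumTo-*ˡ (suc n) x f = trans (distribˡ _ _ _) (+-congʳ (sumTo-*ˡ n x f))

  sumTo-sucˡ : ∀ n f → sumTo (suc n) f ≈ f 0 + sumTo n (λ k → f (suc k))
  sumTo-sucˡ zero    f = refl
  sumTo-sucˡ (suc n) f = trans (+-congʳ (sumTo-sucˡ n f)) (+-assoc _ _ _)

module Contiguity {c ℓ} (F : CharZeroField c ℓ) where
  open FieldFacts F
  open CharZeroField F
  open FieldOps F
  open IntegerSolver F
  open Pochhammer F
  open Sums F
  open import Relation.Binary.Reasoning.Setoid setoid

  ₃F₂-coeff : ℕ → Carrier → Carrier → Carrier → ℕ → Carrier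
  ₃F₂-coeff n d e z k = poch (- ι n) k ÷ (poch 1# k * poch d k * poch e k) * pow z k

  ₃F₂-as-sum : ∀ a b n d e z → ₃F₂ a b n d e z ≈ sumTo n (λ k → poch a k * poch b k * ₃F₂-coeff n d e z k)
  ₃F₂-as-sum a b n d e z = sumTo-cong n λ k _ →
    solve 5 (λ p q r w y → p :* q :* r :* w :* y := p :* q :* (r :* w :* y)) refl
      (poch a k) (poch b k) (poch (- ι n) k) ((poch 1# k * poch d k * poch e k) ⁻¹) (pow z k)

  ₃F₂-cong : ∀ {a a′ b b′} n d e z → a ≈ a′ → b ≈ b′ → ₃F₂ a b n d e z ≈ ₃F₂ a′ b′ n d e z
  ₃F₂-cong n d e z a≈a′ b≈b′ = sumTo-cong n λ k _ →
    *-congʳ (*-congʳ (*-congʳ (*-cong (poch-cong k a≈a′) (poch-cong k b≈b′))))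

  ₃F₂-contiguous : ∀ a b n d e z →
    (a - b) * ₃F₂ a b n d e z ≈ a * ₃F₂ (a + 1#) b n d e z + (- b) * ₃F₂ a (b + 1#) n d e z
  ₃F₂-contiguous a b n d e z = begin
    (a - b) * ₃F₂ a b n d e z                                     ≈⟨ *-congˡ (₃F₂-as-sum a b n d e z) ⟩
    (a - b) * sumTo n (λ k → poch a k * poch b k * coeff k)        ≈⟨ sumTo-*ˡ n _ _ ⟩
    sumTo n (λ k → (a - b) * (poch a k * poch b k * coeff k))      ≈⟨ sumTo-cong n (λ k _ → termwise k) ⟩
    sumTo n (λ k → a * term (a + 1#) b k + (- b) * term a (b + 1#) k)   ≈⟨ sumTo-+ n _ _ ⟩
    sumTo n (λ k → a * term (a + 1#) b k) + sumTo n (λ k → (- b) * term a (b + 1#) k)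
      ≈⟨ sym (+-cong (sumTo-*ˡ n a _) (sumTo-*ˡ n (- b) _)) ⟩
    a * sumTo n (term (a + 1#) b) + (- b) * sumTo n (term a (b + 1#))
      ≈⟨ sym (+-cong (*-congˡ (₃F₂-as-sum (a + 1#) b n d e z)) (*-congˡ (₃F₂-as-sum a (b + 1#) n d e z))) ⟩
    a * ₃F₂ (a + 1#) b n d e z + (- b) * ₃F₂ a (b + 1#) n d e z   ∎
    where
    coeff : ℕ → Carrier
    coeff = ₃F₂-coeff n d e z
    term : Carrier → Carrier → ℕ → Carrier
    term a′ b′ k = poch a′ k * poch b′ k * coeff k
    termwise : ∀ k → (a - b) * (poch a k * poch b k * coeff k) ≈ a * term (a + 1#) b k + (- b) * term a (b + 1#) k
    termwise k = begin
      (a - b) * (poch a k * poch b k * coeff k)   ≈⟨ sym (*-assoc _ _ _) ⟩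
      (a - b) * (poch a k * poch b k) * coeff k   ≈⟨ *-congʳ (poch-contiguous a b k) ⟩
      (a * (poch (a + 1#) k * poch b k) + (- b) * (poch a k * poch (b + 1#) k)) * coeff k
        ≈⟨ solve 5 (λ a b p q c → (a :* p :+ b :* q) :* c := a :* (p :* c) :+ b :* (q :* c)) refl a (- b) _ _ (coeff k) ⟩
      a * term (a + 1#) b k + (- b) * term a (b + 1#) k   ∎

  ₃F₂-coeff-ratio : ∀ n d e z k → poch 1# k * poch d k * poch e k ≉ 0# → (1# + ι k) * (d + ι k) * (e + ι k) ≉ 0# →
    ₃F₂-coeff n d e z (suc k) * ((1# + ι k) * (d + ι k) * (e + ι k)) ≈ ₃F₂-coeff n d e z k * ((- ι n + ι k) * z)
  ₃F₂-coeff-ratio n d e z k D≉0 δ≉0 = begin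
    (p * ν) ÷ (D₁ * α * (D₂ * β) * (D₃ * γ)) * (zᵏ * z) * δ
      ≈⟨ *-congʳ (*-congʳ (÷-cong refl (solve 6 (λ a b c x y w →
             a :* x :* (b :* y) :* (c :* w)
          := a :* b :* c :* (x :* y :* w))
          refl D₁ D₂ D₃ α β γ))) ⟩
    (p * ν) ÷ (D * δ) * (zᵏ * z) * δ
      ≈⟨ solve 4 (λ f z y δ → f :* (y :* z) :* δ := f :* δ :* y :* z) refl ((p * ν) ÷ (D * δ)) z zᵏ δ ⟩
    (p * ν) ÷ (D * δ) * δ * zᵏ * z
      ≈⟨ *-congʳ (*-congʳ (÷-step D≉0 δ≉0)) ⟩
    p ÷ D * ν * zᵏ * z
      ≈⟨ solve 4 (λ f ν y z → f :* ν :* y :* z := f :* y :* (ν :* z)) refl (p ÷ D) ν zᵏ z ⟩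
    p ÷ D * zᵏ * (ν * z)   ∎
    where
    p ν zᵏ D₁ D₂ D₃ α β γ D δ : Carrier
    p = poch (- ι n) k
    ν = - ι n + ι k
    zᵏ = pow z k
    D₁ = poch 1# k
    D₂ = poch d k
    D₃ = poch e k
    α = 1# + ι k
    β = d + ι k
    γ = e + ι k
    D = D₁ * D₂ * D₃
    δ = α * β * γ

module Evaluation {c ℓ} (F : CharZeroField c ℓ) where
  open CharZeroField F
  open FieldOps F
  open IntegerSolver F
  open FieldFacts F
  open Pochhammer F
  open Sums F
  open Contiguity F
  open import Algebra.Properties.CommutativeSemigroup *-commutativeSemigroup using (x∙yz≈y∙xz; interchange)
  open import Relation.Binary.Reasoning.Setoid setoid

  ½ ¾ : Carrier
  ½ = 1# ÷ ι 2
  ¾ = ι 3 ÷ ι 4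

  S : ℕ → Carrier → Carrier
  S n w = ₃F₂ w (1# - w) n ½ (- ι (3 ℕ.* n)) ¾

  G : ℕ → Carrier → Carrier
  G n w = poch ((w + 1#) ÷ ι 3) n * poch ((ι 2 - w) ÷ ι 3) n ÷ (poch (1# ÷ ι 3) n * poch (ι 2 ÷ ι 3) n)

  d : ℕ → Carrier
  d n = (1# + ι 3 * ι n) * (ι 2 + ι 3 * ι n)

  3≉0 : ι 3 ≉ 0#
  3≉0 = ι-suc≉0 2

  d≉0 : ∀ n → d n ≉ 0#
  d≉0 n = *-≉0 (≈ι-suc⇒≉0 (3 ℕ.* n) (+-congˡ (sym (ι-* 3 n))))
               (≈ι-suc⇒≉0 (suc (3 ℕ.* n)) (trans (+-congˡ (sym (ι-* 3 n))) (sym (ι-+ 2 (3 ℕ.* n)))))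

  thirds≉0 : ∀ n → poch (1# ÷ ι 3) n * poch (ι 2 ÷ ι 3) n ≉ 0#
  thirds≉0 n = *-≉0 (poch-≉0 n (λ j _ → fraction+ι≉0 0 2 j (sym (+-identityʳ 1#))))
                    (poch-≉0 n (λ j _ → fraction+ι≉0 1 2 j refl))

  G-suc : ∀ n w → G (suc n) w * ((1# ÷ ι 3 + ι n) * (ι 2 ÷ ι 3 + ι n))
                ≈ G n w * (((w + 1#) ÷ ι 3 + ι n) * ((ι 2 - w) ÷ ι 3 + ι n))
  G-suc n w = begin
    pα * (α + N) * (pβ * (β + N)) ÷ (pγ * (γ + N) * (pδ * (δ + N))) * ((γ + N) * (δ + N))
      ≈⟨ *-congʳ (÷-cong (interchange pα _ pβ _) (interchange pγ _ pδ _)) ⟩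
    pα * pβ * ((α + N) * (β + N)) ÷ (pγ * pδ * ((γ + N) * (δ + N))) * ((γ + N) * (δ + N))
      ≈⟨ ÷-step (thirds≉0 n) (*-≉0 (fraction+ι≉0 0 2 n (sym (+-identityʳ 1#))) (fraction+ι≉0 1 2 n refl)) ⟩
    G n w * ((α + N) * (β + N))   ∎
    where
    N α β γ δ pα pβ pγ pδ : Carrier
    N = ι n
    α = (w + 1#) ÷ ι 3
    β = (ι 2 - w) ÷ ι 3
    γ = 1# ÷ ι 3
    δ = ι 2 ÷ ι 3
    pα = poch α n
    pβ = poch β n
    pγ = poch γ n
    pδ = poch δ n

  G-rec : ∀ n w → d n * G (suc n) w ≈ (d n + w * (1# - w)) * G n w
  G-rec n w = begin
    d n * G (suc n) w
      ≈⟨ *-congʳ (sym (*-cong (thrice 1#) (thrice (ι 2)))) ⟩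
    ι 3 * (γ + N) * (ι 3 * (δ + N)) * G (suc n) w
      ≈⟨ solve 3 (λ g d G → con (+ 3) :* g :* (con (+ 3) :* d) :* G := con (+ 9) :* (G :* (g :* d))) refl (γ + N) (δ + N) (G (suc n) w) ⟩
    ι 9 * (G (suc n) w * ((γ + N) * (δ + N)))
      ≈⟨ *-congˡ (G-suc n w) ⟩
    ι 9 * (G n w * ((α + N) * (β + N)))
      ≈⟨ solve 3 (λ a b G → con (+ 9) :* (G :* (a :* b)) := con (+ 3) :* a :* (con (+ 3) :* b) :* G) refl (α + N) (β + N) (G n w) ⟩
    ι 3 * (α + N) * (ι 3 * (β + N)) * G n w
      ≈⟨ *-congʳ (*-cong (thrice (w + 1#)) (thrice (ι 2 - w))) ⟩
    (w + 1# + ι 3 * N) * (ι 2 - w + ι 3 * N) * G n w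
      ≈⟨ *-congʳ (solve 2 (λ w N →
             (w :+ :1 :+ con (+ 3) :* N) :* (con (+ 2) :- w :+ con (+ 3) :* N)
          := (:1 :+ con (+ 3) :* N) :* (con (+ 2) :+ con (+ 3) :* N) :+ w :* (:1 :- w))
          refl w N) ⟩
    (d n + w * (1# - w)) * G n w   ∎
    where
    N α β γ δ : Carrier
    N = ι n
    α = (w + 1#) ÷ ι 3
    β = (ι 2 - w) ÷ ι 3
    γ = 1# ÷ ι 3
    δ = ι 2 ÷ ι 3
    thrice : ∀ x → ι 3 * (x ÷ ι 3 + N) ≈ x + ι 3 * N
    thrice x = *-÷-+ x N 3≉0

  cf : ℕ → ℕ → Carrier
  cf n = ₃F₂-coeff n ½ (- ι (3 ℕ.* n)) ¾

  E : ℕ → Carrier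
  E k = ι 2 * (1# + ι k) * (1# + ι 2 * ι k)

  ½+ι≉0 : ∀ j → ½ + ι j ≉ 0#
  ½+ι≉0 j = fraction+ι≉0 0 1 j (sym (+-identityʳ 1#))

  E≉0 : ∀ k → E k ≉ 0#
  E≉0 k = *-≉0 (*-≉0 (ι-suc≉0 1) (ι-suc≉0 k)) (≈ι-suc⇒≉0 (2 ℕ.* k) (+-congˡ (sym (ι-* 2 k))))

  cf-denominator≉0 : ∀ n k → k ≤ 3 ℕ.* n → poch 1# k * poch ½ k * poch (- ι (3 ℕ.* n)) k ≉ 0#
  cf-denominator≉0 n k k≤3n = *-≉0 (*-≉0 (poch-1≉0 k) (poch-≉0 k (λ j _ → ½+ι≉0 j)))
                                   (poch-≉0 k (λ j j<k → -ι+ι≉0 (ℕₚ.<-≤-trans j<k k≤3n)))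

  twice-½ : ∀ x → ι 2 * (½ + x) ≈ 1# + ι 2 * x
  twice-½ x = *-÷-+ 1# x (ι-suc≉0 1)

  four-¾ : ι 4 * ¾ ≈ ι 3
  four-¾ = trans (*-comm _ _) (÷-*-cancel (ι 3) (ι-suc≉0 3))

  cf-ratio₁ : ∀ n k → k < n → cf n (suc k) * (E k * (ι k - ι 3 * ι n)) ≈ cf n k * (ι 3 * (ι k - ι n))
  cf-ratio₁ n k k<n = *-rescale (ι 4) raw scale-δ scale-ν
    where
    K N e : Carrier
    K = ι k
    N = ι n
    e = - ι (3 ℕ.* n)
    k<3n : k < 3 ℕ.* n
    k<3n = ℕₚ.<-≤-trans k<n (ℕₚ.m≤n*m n 3)
    raw : cf n (suc k) * ((1# + K) * (½ + K) * (e + K)) ≈ cf n k * ((- N + K) * ¾)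
    raw = ₃F₂-coeff-ratio n ½ e ¾ k (cf-denominator≉0 n k (ℕₚ.<⇒≤ k<3n))
            (*-≉0 (*-≉0 (ι-suc≉0 k) (½+ι≉0 k)) (-ι+ι≉0 k<3n))
    scale-δ : ι 4 * ((1# + K) * (½ + K) * (e + K)) ≈ E k * (K - ι 3 * N)
    scale-δ = begin
      ι 4 * ((1# + K) * (½ + K) * (e + K))
        ≈⟨ solve 3 (λ K h e →
               con (+ 4) :* ((:1 :+ K) :* (h :+ K) :* (e :+ K))
            := con (+ 2) :* (:1 :+ K) :* (con (+ 2) :* (h :+ K)) :* (e :+ K))
            refl K ½ e ⟩
      ι 2 * (1# + K) * (ι 2 * (½ + K)) * (e + K)
        ≈⟨ *-cong (*-congˡ (twice-½ K)) (+-congʳ (-‿cong (ι-* 3 n))) ⟩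
      ι 2 * (1# + K) * (1# + ι 2 * K) * (- (ι 3 * N) + K)
        ≈⟨ solve 2 (λ K N →
               con (+ 2) :* (:1 :+ K) :* (:1 :+ con (+ 2) :* K) :* (:- (con (+ 3) :* N) :+ K)
            := con (+ 2) :* (:1 :+ K) :* (:1 :+ con (+ 2) :* K) :* (K :- con (+ 3) :* N))
            refl K N ⟩
      E k * (K - ι 3 * N)   ∎
    scale-ν : ι 4 * ((- N + K) * ¾) ≈ ι 3 * (K - N)
    scale-ν = begin
      ι 4 * ((- N + K) * ¾)    ≈⟨ solve 3 (λ N K q → con (+ 4) :* ((:- N :+ K) :* q) := (K :- N) :* (con (+ 4) :* q)) refl N K ¾ ⟩
      (K - N) * (ι 4 * ¾)      ≈⟨ *-congˡ four-¾ ⟩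
      (K - N) * ι 3            ≈⟨ *-comm _ _ ⟩
      ι 3 * (K - N)            ∎

  cf-ratio₂ : ∀ n k → k ≤ n →
    cf (suc n) (suc k) * (E k * d n) ≈ cf n k * ((ι k - ι 3 * ι n - 1#) * (ι k - ι 3 * ι n - ι 2))
  cf-ratio₂ n k k≤n = *-cancel-common (-‿≉0 ψ≉0) (*-rescale (ι 4) raw scale-δ scale-ν)
    where
    K N e e′ ψ : Carrier
    K = ι k
    N = ι n
    e = - ι (3 ℕ.* n)
    e′ = - ι (3 ℕ.* suc n)
    ψ = ι 3 * (1# + N)
    ψ≉0 : ψ ≉ 0#
    ψ≉0 = *-≉0 3≉0 (ι-suc≉0 n)
    e′≈-ψ : e′ ≈ - ψ
    e′≈-ψ = -‿cong (ι-* 3 (suc n))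
    p p′ qᵏ f h eₖ e′₃ e′ₖ₊₁ e′₂ D D′ δ ν : Carrier
    p = poch (- N) k
    p′ = poch (- ι (suc n)) (suc k)
    qᵏ = pow ¾ k
    f = poch 1# k
    h = poch ½ k
    eₖ = poch e k
    e′₃ = poch e′ 3
    e′ₖ₊₁ = poch e′ (suc k)
    e′₂ = poch (e′ + ι (suc k)) 2
    D = f * h * eₖ
    D′ = f * (1# + K) * (h * (½ + K)) * e′ₖ₊₁
    δ = (1# + K) * (½ + K) * e′₃
    ν = - (1# + N) * ¾ * e′₂
    p′≈ : p′ ≈ - (1# + N) * p
    p′≈ = trans (poch-sucˡ _ k) (*-congˡ (poch-cong k (solve 1 (λ N → :- (:1 :+ N) :+ :1 := :- N) refl N)))
    shift : e′₃ * eₖ ≈ e′ₖ₊₁ * e′₂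
    shift = begin
      e′₃ * eₖ                       ≈⟨ *-congˡ (poch-cong k e≈e′+3) ⟩
      e′₃ * poch (e′ + ι 3) k        ≈⟨ sym (poch-+ e′ 3 k) ⟩
      poch e′ (3 ℕ.+ k)              ≡⟨ ≡.cong (λ m → poch e′ (suc m)) (ℕₚ.+-comm 2 k) ⟩
      poch e′ (suc k ℕ.+ 2)          ≈⟨ poch-+ e′ (suc k) 2 ⟩
      e′ₖ₊₁ * e′₂                    ∎
      where
      e≈e′+3 : e ≈ e′ + ι 3
      e≈e′+3 = begin
        - ι (3 ℕ.* n)                    ≈⟨ solve 2 (λ x t → :- x := :- (t :+ x) :+ t) refl (ι (3 ℕ.* n)) (ι 3) ⟩
        - (ι 3 + ι (3 ℕ.* n)) + ι 3      ≈⟨ +-congʳ (-‿cong (sym (ι-+ 3 (3 ℕ.* n)))) ⟩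
        - ι (3 ℕ.+ 3 ℕ.* n) + ι 3        ≡⟨ ≡.cong (λ m → - ι m + ι 3) (≡.sym (ℕₚ.*-suc 3 n)) ⟩
        e′ + ι 3                         ∎
    cross : p′ * (qᵏ * ¾) * δ * D ≈ p * qᵏ * ν * D′
    cross = begin
      p′ * (qᵏ * ¾) * δ * D
        ≈⟨ *-congʳ (*-congʳ (*-congʳ p′≈)) ⟩
      - (1# + N) * p * (qᵏ * ¾) * ((1# + K) * (½ + K) * e′₃) * (f * h * eₖ)
        ≈⟨ solve 10 (λ N p q t K s f h a b →
               :- (:1 :+ N) :* p :* (q :* t) :* ((:1 :+ K) :* (s :+ K) :* a) :* (f :* h :* b)
            := :- (:1 :+ N) :* p :* q :* t :* (:1 :+ K) :* (s :+ K) :* f :* h :* (a :* b))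
            refl N p qᵏ ¾ K ½ f h e′₃ eₖ ⟩
      - (1# + N) * p * qᵏ * ¾ * (1# + K) * (½ + K) * f * h * (e′₃ * eₖ)
        ≈⟨ *-congˡ shift ⟩
      - (1# + N) * p * qᵏ * ¾ * (1# + K) * (½ + K) * f * h * (e′ₖ₊₁ * e′₂)
        ≈⟨ solve 10 (λ N p q t K s f h a b →
               :- (:1 :+ N) :* p :* q :* t :* (:1 :+ K) :* (s :+ K) :* f :* h :* (a :* b)
            := p :* q :* (:- (:1 :+ N) :* t :* b) :* (f :* (:1 :+ K) :* (h :* (s :+ K)) :* a))
            refl N p qᵏ ¾ K ½ f h e′ₖ₊₁ e′₂ ⟩
      p * qᵏ * ν * D′   ∎
    raw : cf (suc n) (suc k) * δ ≈ cf n k * ν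
    raw = begin
      p′ ÷ D′ * (qᵏ * ¾) * δ        ≈⟨ solve 4 (λ a w q δ → a :* w :* q :* δ := a :* q :* δ :* w) refl p′ (D′ ⁻¹) (qᵏ * ¾) δ ⟩
      p′ * (qᵏ * ¾) * δ ÷ D′        ≈⟨ ÷-cross D′≉0 D≉0 cross ⟩
      p * qᵏ * ν ÷ D                ≈⟨ solve 4 (λ p q ν w → p :* q :* ν :* w := p :* w :* q :* ν) refl p qᵏ ν (D ⁻¹) ⟩
      p ÷ D * qᵏ * ν                ∎
      where
      D′≉0 : D′ ≉ 0#
      D′≉0 = cf-denominator≉0 (suc n) (suc k) (ℕₚ.≤-trans (s≤s k≤n) (ℕₚ.m≤n*m (suc n) 3))
      D≉0 : D ≉ 0#
      D≉0 = cf-denominator≉0 n k (ℕₚ.≤-trans k≤n (ℕₚ.m≤n*m n 3))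
    scale-δ : ι 4 * δ ≈ - ψ * (E k * d n)
    scale-δ = begin
      ι 4 * ((1# + K) * (½ + K) * e′₃)
        ≈⟨ solve 3 (λ K s a →
               con (+ 4) :* ((:1 :+ K) :* (s :+ K) :* a)
            := con (+ 2) :* (:1 :+ K) :* (con (+ 2) :* (s :+ K)) :* a)
            refl K ½ e′₃ ⟩
      ι 2 * (1# + K) * (ι 2 * (½ + K)) * e′₃
        ≈⟨ *-cong (*-congˡ (twice-½ K)) (poch-cong 3 e′≈-ψ) ⟩
      ι 2 * (1# + K) * (1# + ι 2 * K) * poch (- ψ) 3
        ≈⟨ solve 2 (λ K N →
               con (+ 2) :* (:1 :+ K) :* (:1 :+ con (+ 2) :* K)
                 :* (:1 :* (:- (con (+ 3) :* (:1 :+ N)) :+ con (+ 0))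
                        :* (:- (con (+ 3) :* (:1 :+ N)) :+ con (+ 1))
                        :* (:- (con (+ 3) :* (:1 :+ N)) :+ con (+ 2)))
            := :- (con (+ 3) :* (:1 :+ N))
                 :* (con (+ 2) :* (:1 :+ K) :* (:1 :+ con (+ 2) :* K)
                     :* ((:1 :+ con (+ 3) :* N) :* (con (+ 2) :+ con (+ 3) :* N))))
            refl K N ⟩
      - ψ * (E k * d n)   ∎
    scale-ν : ι 4 * ν ≈ - ψ * ((K - ι 3 * N - 1#) * (K - ι 3 * N - ι 2))
    scale-ν = begin
      ι 4 * (- (1# + N) * ¾ * e′₂)
        ≈⟨ solve 3 (λ N t a → con (+ 4) :* (:- (:1 :+ N) :* t :* a) := :- (:1 :+ N) :* (con (+ 4) :* t) :* a)
                   refl N ¾ e′₂ ⟩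
      - (1# + N) * (ι 4 * ¾) * e′₂
        ≈⟨ *-cong (*-congˡ four-¾) (poch-cong 2 (+-congʳ e′≈-ψ)) ⟩
      - (1# + N) * ι 3 * poch (- ψ + (1# + K)) 2
        ≈⟨ solve 2 (λ K N →
               :- (:1 :+ N) :* con (+ 3)
                 :* (:1 :* (:- (con (+ 3) :* (:1 :+ N)) :+ (:1 :+ K) :+ con (+ 0))
                        :* (:- (con (+ 3) :* (:1 :+ N)) :+ (:1 :+ K) :+ con (+ 1)))
            := :- (con (+ 3) :* (:1 :+ N)) :* ((K :- con (+ 3) :* N :- :1) :* (K :- con (+ 3) :* N :- con (+ 2))))
            refl K N ⟩
      - ψ * ((K - ι 3 * N - 1#) * (K - ι 3 * N - ι 2))   ∎

  cf-top : ∀ n → cf n (suc n) ≈ 0#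
  cf-top n = begin
    poch (- ι n) n * (- ι n + ι n) ÷ D * pow ¾ (suc n)
      ≈⟨ *-congʳ (*-congʳ (*-congˡ (-‿inverseˡ (ι n)))) ⟩
    poch (- ι n) n * 0# ÷ D * pow ¾ (suc n)
      ≈⟨ solve 3 (λ p w q → p :* con (+ 0) :* w :* q := con (+ 0)) refl (poch (- ι n) n) (D ⁻¹) (pow ¾ (suc n)) ⟩
    0#   ∎
    where
    D : Carrier
    D = poch 1# (suc n) * poch ½ (suc n) * poch (- ι (3 ℕ.* n)) (suc n)

  cf-rec : ∀ n k → k ≤ n →
    d n * cf (suc n) (suc k) ≈ cf n (suc k) * (d n - ι (suc k) * ι (suc (suc k))) + cf n k
  -- For k = n the ratio cf-ratio₁ is not available, but then cf n (suc n) vanishes.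
  cf-rec n k k≤n with ℕₚ.m≤n⇒m<n∨m≡n k≤n
  ... | inj₁ k<n = *-cancelˡ Z≉0 (begin
    Z * (d n * c₂)
      ≈⟨ solve 5 (λ K N e d c →
             e :* (K :- con (+ 3) :* N) :* (d :* c)
          := (K :- con (+ 3) :* N) :* (c :* (e :* d)))
          refl K N (E k) (d n) c₂ ⟩
    (K - ι 3 * N) * (c₂ * (E k * d n))
      ≈⟨ *-congˡ (cf-ratio₂ n k k≤n) ⟩
    (K - ι 3 * N) * (c₀ * ((K - ι 3 * N - 1#) * (K - ι 3 * N - ι 2)))
      ≈⟨ solve 3 (λ K N c →
             (K :- con (+ 3) :* N) :* (c :* ((K :- con (+ 3) :* N :- :1) :* (K :- con (+ 3) :* N :- con (+ 2))))
          := ((:1 :+ con (+ 3) :* N) :* (con (+ 2) :+ con (+ 3) :* N) :- (:1 :+ K) :* (:1 :+ (:1 :+ K)))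
               :* (c :* (con (+ 3) :* (K :- N)))
             :+ con (+ 2) :* (:1 :+ K) :* (:1 :+ con (+ 2) :* K) :* (K :- con (+ 3) :* N) :* c)
          refl K N c₀ ⟩
    X * (c₀ * (ι 3 * (K - N))) + Z * c₀
      ≈⟨ +-congʳ (*-congˡ (sym (cf-ratio₁ n k k<n))) ⟩
    X * (c₁ * Z) + Z * c₀
      ≈⟨ solve 4 (λ X c z b → X :* (c :* z) :+ z :* b := z :* (c :* X :+ b)) refl X c₁ Z c₀ ⟩
    Z * (c₁ * X + c₀)   ∎)
    where
    K N c₀ c₁ c₂ X Z : Carrier
    K = ι k
    N = ι n
    c₀ = cf n k
    c₁ = cf n (suc k)
    c₂ = cf (suc n) (suc k)
    X = d n - ι (suc k) * ι (suc (suc k))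
    Z = E k * (K - ι 3 * N)
    Z≉0 : Z ≉ 0#
    Z≉0 = *-≉0 (E≉0 k) (≉0-factorˡ {y = 1#}
      (trans (sym (trans (+-comm K _) (+-congʳ (-‿cong (sym (ι-* 3 n)))))) (sym (*-identityʳ _)))
      (-ι+ι≉0 (ℕₚ.<-≤-trans k<n (ℕₚ.m≤n*m n 3))))
  ... | inj₂ ≡.refl = *-cancelˡ (E≉0 k) (begin
    E k * (d k * c₂)
      ≈⟨ solve 3 (λ e d c → e :* (d :* c) := c :* (e :* d)) refl (E k) (d k) c₂ ⟩
    c₂ * (E k * d k)
      ≈⟨ cf-ratio₂ k k k≤n ⟩
    c₀ * ((K - ι 3 * K - 1#) * (K - ι 3 * K - ι 2))
      ≈⟨ solve 2 (λ K c →
             c :* ((K :- con (+ 3) :* K :- :1) :* (K :- con (+ 3) :* K :- con (+ 2)))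
          := con (+ 2) :* (:1 :+ K) :* (:1 :+ con (+ 2) :* K) :* c)
          refl K c₀ ⟩
    E k * c₀
      ≈⟨ *-congˡ (sym (trans (+-congʳ (trans (*-congʳ (cf-top k)) (zeroˡ _))) (+-identityˡ c₀))) ⟩
    E k * (cf k (suc k) * (d k - ι (suc k) * ι (suc (suc k))) + c₀)   ∎)
    where
    K c₀ c₂ : Carrier
    K = ι k
    c₀ = cf k k
    c₂ = cf (suc k) (suc k)

  V : Carrier → ℕ → Carrier
  V w k = poch w k * poch (1# - w) k

  V-suc : ∀ w k → V w (suc k) ≈ (ι k * ι (suc k) + w * (1# - w)) * V w k
  V-suc w k = solve 4 (λ w K p q → p :* (w :+ K) :* (q :* ((:1 :- w) :+ K)) := (K :* (:1 :+ K) :+ w :* (:1 :- w)) :* (p :* q))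
    refl w (ι k) (poch w k) (poch (1# - w) k)

  S-rec : ∀ n w → d n * S (suc n) w ≈ (d n + w * (1# - w)) * S n w
  S-rec n w = begin
    d n * S (suc n) w                                       ≈⟨ *-congˡ (₃F₂-as-sum w (1# - w) (suc n) ½ _ ¾) ⟩
    d n * sumTo (suc n) (λ k → V w k * cf (suc n) k)        ≈⟨ sumTo-*ˡ (suc n) _ _ ⟩
    sumTo (suc n) (λ k → d n * (V w k * cf (suc n) k))      ≈⟨ sumTo-sucˡ n _ ⟩
    d n * (V w 0 * cf (suc n) 0) + sumTo n (λ k → d n * (V w (suc k) * cf (suc n) (suc k)))
      ≈⟨ +-cong head (sumTo-cong n tail) ⟩
    A 0 + sumTo n (λ k → A (suc k) + B k)                   ≈⟨ +-congˡ (sumTo-+ n _ _) ⟩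
    A 0 + (sumTo n (λ k → A (suc k)) + sumTo n B)           ≈⟨ sym (+-assoc _ _ _) ⟩
    A 0 + sumTo n (λ k → A (suc k)) + sumTo n B             ≈⟨ +-congʳ (sym (sumTo-sucˡ n A)) ⟩
    sumTo n A + A (suc n) + sumTo n B                       ≈⟨ +-congʳ (trans (+-congˡ A-top) (+-identityʳ _)) ⟩
    sumTo n A + sumTo n B                                   ≈⟨ sym (sumTo-+ n A B) ⟩
    sumTo n (λ k → A k + B k)                               ≈⟨ sumTo-cong n (λ k _ → merge k) ⟩
    sumTo n (λ k → (d n + v) * (V w k * cf n k))            ≈⟨ sym (sumTo-*ˡ n _ _) ⟩
    (d n + v) * sumTo n (λ k → V w k * cf n k)              ≈⟨ *-congˡ (sym (₃F₂-as-sum w (1# - w) n ½ _ ¾)) ⟩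
    (d n + v) * S n w                                       ∎
    where
    v : Carrier
    v = w * (1# - w)
    A : ℕ → Carrier
    A k = (d n - ι k * ι (suc k)) * (V w k * cf n k)
    B : ℕ → Carrier
    B k = V w (suc k) * cf n k
    head : d n * (V w 0 * cf (suc n) 0) ≈ A 0
    head = solve 3 (λ d a c → d :* (a :* c) := (d :- con (+ 0) :* con (+ 1)) :* (a :* c)) refl (d n) (V w 0) (cf n 0)
    tail : ∀ k → k ≤ n → d n * (V w (suc k) * cf (suc n) (suc k)) ≈ A (suc k) + B k
    tail k k≤n = begin
      d n * (V w (suc k) * cf (suc n) (suc k))
        ≈⟨ x∙yz≈y∙xz (d n) _ _ ⟩
      V w (suc k) * (d n * cf (suc n) (suc k))
        ≈⟨ *-congˡ (cf-rec n k k≤n) ⟩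
      V w (suc k) * (cf n (suc k) * X + cf n k)
        ≈⟨ solve 4 (λ a c X b → a :* (c :* X :+ b) := X :* (a :* c) :+ a :* b) refl (V w (suc k)) (cf n (suc k)) X (cf n k) ⟩
      A (suc k) + B k   ∎
      where
      X : Carrier
      X = d n - ι (suc k) * ι (suc (suc k))
    A-top : A (suc n) ≈ 0#
    A-top = trans (*-congˡ (trans (*-congˡ (cf-top n)) (zeroʳ _))) (zeroʳ _)
    merge : ∀ k → A k + B k ≈ (d n + v) * (V w k * cf n k)
    merge k = begin
      (d n - ι k * ι (suc k)) * (V w k * cf n k) + V w (suc k) * cf n k
        ≈⟨ +-congˡ (*-congʳ (V-suc w k)) ⟩
      (d n - ι k * ι (suc k)) * (V w k * cf n k) + (ι k * ι (suc k) + v) * V w k * cf n k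
        ≈⟨ solve 5 (λ d j v a c →
               (d :- j) :* (a :* c) :+ (j :+ v) :* a :* c
            := (d :+ v) :* (a :* c))
            refl (d n) (ι k * ι (suc k)) v (V w k) (cf n k) ⟩
      (d n + v) * (V w k * cf n k)   ∎

  S≈G : ∀ n w → S n w ≈ G n w
  S≈G zero    w = trans (trans (*-identityʳ _) (÷-self (*-≉0 (*-≉0 1≉0 1≉0) 1≉0))) (sym (÷-self (*-≉0 1≉0 1≉0)))
  S≈G (suc n) w = *-cancelˡ (d≉0 n) (begin
    d n * S (suc n) w                ≈⟨ S-rec n w ⟩
    (d n + w * (1# - w)) * S n w     ≈⟨ *-congˡ (S≈G n w) ⟩
    (d n + w * (1# - w)) * G n w     ≈⟨ sym (G-rec n w) ⟩
    d n * G (suc n) w                ∎)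

  G-cong : ∀ n {a b} → a ≈ b → G n a ≈ G n b
  G-cong n a≈b = *-congʳ (*-cong (poch-cong n (÷-cong (+-congʳ a≈b) refl)) (poch-cong n (÷-cong (+-congˡ (-‿cong a≈b)) refl)))

module Weights {c ℓ} (F : CharZeroField c ℓ) where
  open CharZeroField F
  open FieldOps F
  open IntegerSolver F
  open FieldFacts F
  open Pochhammer F
  open Sums F
  open import Relation.Binary.Reasoning.Setoid setoid

  Avoids : Carrier → ℕ → Set ℓ
  Avoids t b = ∀ m → m < b → t + ι m ≉ 0#

  ι-+-assoc : ∀ t a m → t + ι a + ι m ≈ t + ι (a ℕ.+ m)
  ι-+-assoc t a m = trans (+-assoc t _ _) (+-congˡ (sym (ι-+ a m)))

  poch-avoids≉0 : ∀ {t b} a k → Avoids t b → a ℕ.+ k ≤ b → poch (t + ι a) k ≉ 0#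
  poch-avoids≉0 {t} a k avoids a+k≤b = poch-≉0 k λ m m<k t+a+m≈0 →
    avoids (a ℕ.+ m) (ℕₚ.<-≤-trans (ℕₚ.+-monoʳ-< a m<k) a+k≤b) (trans (sym (ι-+-assoc t a m)) t+a+m≈0)

  P : Carrier → Carrier → ℕ → Carrier
  P u t l = poch u l ÷ poch t l

  K : Carrier → ℕ → ℕ → Carrier
  K t l i = pow (- 1#) i * ((t + ι (2 ℕ.* i) - 1#) ÷ (t - 1#))
            * ((poch (- ι l) i * poch (t - 1#) i) ÷ (poch 1# i * poch (t + ι l) i))

  τ : Carrier → ℕ → Carrier
  τ t l = t * (t + 1#) ÷ ((t + ι l) * (t + ι (suc l)))

  R : Carrier → Carrier → ℕ → (ℕ → Carrier) → Carrier
  R u t l g = P u t l * sumTo l (λ i → K t l i * g i)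

  P-zero : ∀ u t → P u t 0 ≈ 1#
  P-zero u t = ÷-self 1≉0

  K-zero : ∀ t l → t - 1# ≉ 0# → K t l 0 ≈ 1#
  K-zero t l t-1≉0 = begin
    1# * ((t + 0# - 1#) ÷ (t - 1#)) * ((1# * 1#) ÷ (1# * 1#))
      ≈⟨ *-cong (*-congˡ (÷-cong (+-congʳ (+-identityʳ t)) refl)) (÷-self (*-≉0 1≉0 1≉0)) ⟩
    1# * ((t - 1#) ÷ (t - 1#)) * 1#
      ≈⟨ *-congʳ (*-congˡ (÷-self t-1≉0)) ⟩
    1# * 1# * 1#
      ≈⟨ trans (*-identityʳ _) (*-identityˡ 1#) ⟩
    1#   ∎

  K-top : ∀ t l → K t l (suc l) ≈ 0#
  K-top t l = begin
    s * a * (poch (- ι l) l * (- ι l + ι l) * b ÷ D)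
      ≈⟨ *-congˡ (*-congʳ (*-congʳ (*-congˡ (-‿inverseˡ (ι l))))) ⟩
    s * a * (poch (- ι l) l * 0# * b ÷ D)
      ≈⟨ solve 5 (λ s a p b w → s :* a :* (p :* con (+ 0) :* b :* w) := con (+ 0)) refl s a (poch (- ι l) l) b (D ⁻¹) ⟩
    0#   ∎
    where
    s a b D : Carrier
    s = pow (- 1#) (suc l)
    a = (t + ι (2 ℕ.* suc l) - 1#) ÷ (t - 1#)
    b = poch (t - 1#) (suc l)
    D = poch 1# (suc l) * poch (t + ι l) (suc l)

  K-as-fraction : ∀ t l i → t - 1# ≉ 0# → poch 1# i * poch (t + ι l) i ≉ 0# →
    K t l i ≈ pow (- 1#) i * (t + ι (2 ℕ.* i) - 1#) * (poch (- ι l) i * poch (t - 1#) i)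
              ÷ ((t - 1#) * (poch 1# i * poch (t + ι l) i))
  K-as-fraction t l i t-1≉0 D≉0 = begin
    s * (a ÷ (t - 1#)) * (b ÷ D)
      ≈⟨ *-assoc s _ _ ⟩
    s * (a ÷ (t - 1#) * (b ÷ D))
      ≈⟨ *-congˡ (÷-*-÷ t-1≉0 D≉0) ⟩
    s * (a * b ÷ ((t - 1#) * D))
      ≈⟨ solve 4 (λ s a b w → s :* (a :* b :* w) := s :* a :* b :* w) refl s a b (((t - 1#) * D) ⁻¹) ⟩
    s * a * b ÷ ((t - 1#) * D)   ∎
    where
    s a b D : Carrier
    s = pow (- 1#) i
    a = t + ι (2 ℕ.* i) - 1#
    b = poch (- ι l) i * poch (t - 1#) i
    D = poch 1# i * poch (t + ι l) i

  P-step-l : ∀ u t l → poch t l ≉ 0# → t + ι l ≉ 0# → (t + ι l) * P u t (suc l) ≈ (u + ι l) * P u t l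
  P-step-l u t l Tₗ≉0 t+l≉0 = trans (*-comm _ _) (trans (÷-step Tₗ≉0 t+l≉0) (*-comm _ _))

  P-step-u : ∀ u t l → poch t l ≉ 0# → poch (t + ι 2) l ≉ 0# → (t + ι l) * (t + ι (suc l)) ≉ 0# →
    u * P (u + 1#) (t + ι 2) l ≈ (u + ι l) * P u t l * τ t l
  P-step-u u t l Tₗ≉0 T₂≉0 Δ≉0 = begin
    u * (poch (u + 1#) l ÷ T₂)                     ≈⟨ sym (*-assoc u _ _) ⟩
    u * poch (u + 1#) l ÷ T₂                       ≈⟨ ÷-cross T₂≉0 (*-≉0 Tₗ≉0 Δ≉0) cross ⟩
    (u + ι l) * poch u l * (t * (t + 1#)) ÷ (Tₗ * Δ)  ≈⟨ sym (÷-*-÷ Tₗ≉0 Δ≉0) ⟩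
    (u + ι l) * poch u l ÷ Tₗ * (t * (t + 1#) ÷ Δ)    ≈⟨ *-congʳ (*-assoc _ _ _) ⟩
    (u + ι l) * P u t l * τ t l                       ∎
    where
    Tₗ T₂ Δ : Carrier
    Tₗ = poch t l
    T₂ = poch (t + ι 2) l
    Δ = (t + ι l) * (t + ι (suc l))
    cross : u * poch (u + 1#) l * (Tₗ * Δ) ≈ (u + ι l) * poch u l * (t * (t + 1#)) * T₂
    cross = begin
      u * poch (u + 1#) l * (Tₗ * Δ)
        ≈⟨ *-cong (sym (poch-sucˡ u l)) (sym (*-assoc _ _ _)) ⟩
      poch u l * (u + ι l) * poch t (suc (suc l))
        ≈⟨ *-congˡ (trans (poch-sucˡ t (suc l)) (*-congˡ (trans (poch-sucˡ (t + 1#) l) (*-congˡ (poch-cong l t+1+1≈t+2))))) ⟩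
      poch u l * (u + ι l) * (t * ((t + 1#) * T₂))
        ≈⟨ solve 5 (λ p u t T L →
               p :* (u :+ L) :* (t :* ((t :+ :1) :* T))
            := (u :+ L) :* p :* (t :* (t :+ :1)) :* T)
            refl (poch u l) u t T₂ (ι l) ⟩
      (u + ι l) * poch u l * (t * (t + 1#)) * T₂   ∎
      where
      t+1+1≈t+2 : t + 1# + 1# ≈ t + ι 2
      t+1+1≈t+2 = solve 1 (λ t → t :+ :1 :+ :1 := t :+ con (+ 2)) refl t

  -- The three weights in K-contiguous are M t l j times a polynomial in t, l and j.
  M : Carrier → ℕ → ℕ → Carrier
  M t l j = pow (- 1#) j * poch (- ι l) j * poch t j ÷ (poch 1# (suc j) * poch (t + ι l) (suc (suc j)))

  +≤2*suc : ∀ {l a b} → a ≤ suc l → b ≤ suc l → a ℕ.+ b ≤ 2 ℕ.* suc l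
  +≤2*suc {l} a≤ b≤ = ℕₚ.≤-trans (ℕₚ.+-mono-≤ a≤ b≤) (ℕₚ.≤-reflexive (≡.cong (suc l ℕ.+_) (≡.sym (ℕₚ.+-identityʳ (suc l)))))

  +<2*suc : ∀ {l a b} → a ≤ suc l → b ≤ l → a ℕ.+ b < 2 ℕ.* suc l
  +<2*suc {l} {a} {b} a≤ b≤l = ℕₚ.≤-trans (ℕₚ.≤-reflexive (≡.sym (ℕₚ.+-suc a b))) (+≤2*suc a≤ (s≤s b≤l))

  module _ {t : Carrier} {l : ℕ} (t-1≉0 : t - 1# ≉ 0#) (avoids : Avoids t (2 ℕ.* suc l)) where

    private
      L : Carrier
      L = ι l
      sʲ : ℕ → Carrier
      sʲ j = pow (- 1#) j
      Mn Md : ℕ → Carrier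
      Mn j = sʲ j * poch (- L) j * poch t j
      Md j = poch 1# (suc j) * poch (t + L) (suc (suc j))
      odd : ℕ → Carrier
      odd j = t + ι 2 * ι j + 1#

      Md≉0 : ∀ j → j ≤ l → Md j ≉ 0#
      Md≉0 j j≤l = *-≉0 (poch-1≉0 (suc j)) (poch-avoids≉0 l (suc (suc j)) avoids
        (ℕₚ.≤-trans (ℕₚ.≤-reflexive (ℕₚ.+-suc l (suc j))) (+≤2*suc ℕₚ.≤-refl (s≤s j≤l))))

      poch[t-1] : ∀ j → poch (t - 1#) (suc j) ≈ (t - 1#) * poch t j
      poch[t-1] j = trans (poch-sucˡ _ j) (*-congˡ (poch-cong j (solve 1 (λ t → t :- :1 :+ :1 := t) refl t)))

      M-form : ∀ {num den} j c → den ≉ 0# → j ≤ l → num * Md j ≈ Mn j * c * den → num ÷ den ≈ M t l j * c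
      M-form {num} {den} j c den≉0 j≤l cross = begin
        num ÷ den              ≈⟨ ÷-cross den≉0 (Md≉0 j j≤l) cross ⟩
        Mn j * c ÷ Md j        ≈⟨ solve 3 (λ m c w → m :* c :* w := m :* w :* c) refl (Mn j) c (Md j ⁻¹) ⟩
        M t l j * c            ∎

    K-suc-suc≈M : ∀ j → j ≤ l → K t (suc l) (suc j) ≈ M t l j * (odd j * (1# + L) * (t + L))
    K-suc-suc≈M j j≤l =
      trans (K-as-fraction t (suc l) (suc j) t-1≉0 den≉0) (M-form j _ (*-≉0 t-1≉0 den≉0) j≤l (begin
        sʲ j * - 1# * (t + ι (2 ℕ.* suc j) - 1#) * (poch (- ι (suc l)) (suc j) * poch (t - 1#) (suc j))
          * (Fj * poch (t + L) (suc (suc j)))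
          ≈⟨ *-cong (*-cong (*-congˡ (+-congʳ (+-congˡ (ι-* 2 (suc j))))) (*-cong -[1+l]-poch (poch[t-1] j)))
                    (*-congˡ (poch-sucˡ (t + L) (suc j))) ⟩
        sʲ j * - 1# * (t + ι 2 * (1# + J) - 1#) * (- (1# + L) * B * ((t - 1#) * C)) * (Fj * ((t + L) * Q))
          ≈⟨ solve 8 (λ z t J L B C f Q →
                 z :* :- :1 :* (t :+ con (+ 2) :* (:1 :+ J) :- :1) :* (:- (:1 :+ L) :* B :* ((t :- :1) :* C))
                   :* (f :* ((t :+ L) :* Q))
              := z :* B :* C :* ((t :+ con (+ 2) :* J :+ :1) :* (:1 :+ L) :* (t :+ L)) :* ((t :- :1) :* (f :* Q)))
              refl (sʲ j) t J L B C Fj Q ⟩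
        Mn j * (odd j * (1# + L) * (t + L)) * ((t - 1#) * (Fj * Q))
          ≈⟨ *-congˡ (*-congˡ (*-congˡ (poch-cong (suc j) (trans (+-assoc t L 1#) (+-congˡ (+-comm L 1#)))))) ⟩
        Mn j * (odd j * (1# + L) * (t + L)) * ((t - 1#) * (Fj * poch (t + ι (suc l)) (suc j)))   ∎))
      where
      J B C Fj Q : Carrier
      J = ι j
      B = poch (- L) j
      C = poch t j
      Fj = poch 1# (suc j)
      Q = poch (t + L + 1#) (suc j)
      den≉0 : poch 1# (suc j) * poch (t + ι (suc l)) (suc j) ≉ 0#
      den≉0 = *-≉0 (poch-1≉0 (suc j)) (poch-avoids≉0 (suc l) (suc j) avoids (+≤2*suc ℕₚ.≤-refl (s≤s j≤l)))
      -[1+l]-poch : poch (- ι (suc l)) (suc j) ≈ - (1# + L) * B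
      -[1+l]-poch = trans (poch-sucˡ _ j) (*-congˡ (poch-cong j (solve 1 (λ L → :- (:1 :+ L) :+ :1 := :- L) refl L)))

    K-suc≈M : ∀ j → j ≤ l → K t l (suc j) ≈ M t l j * (odd j * (L - ι j) * (t + L + ι (suc j)))
    K-suc≈M j j≤l =
      trans (K-as-fraction t l (suc j) t-1≉0 den≉0) (M-form j _ (*-≉0 t-1≉0 den≉0) j≤l (begin
        sʲ j * - 1# * (t + ι (2 ℕ.* suc j) - 1#) * (B * (- L + J) * poch (t - 1#) (suc j))
          * (Fj * (T * (t + L + ι (suc j))))
          ≈⟨ *-congʳ (*-cong (*-congˡ (+-congʳ (+-congˡ (ι-* 2 (suc j))))) (*-congˡ (poch[t-1] j))) ⟩
        sʲ j * - 1# * (t + ι 2 * (1# + J) - 1#) * (B * (- L + J) * ((t - 1#) * C)) * (Fj * (T * (t + L + (1# + J))))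
          ≈⟨ solve 8 (λ z t J L B C f T →
                 z :* :- :1 :* (t :+ con (+ 2) :* (:1 :+ J) :- :1) :* (B :* (:- L :+ J) :* ((t :- :1) :* C))
                   :* (f :* (T :* (t :+ L :+ (:1 :+ J))))
              := z :* B :* C :* ((t :+ con (+ 2) :* J :+ :1) :* (L :- J) :* (t :+ L :+ (:1 :+ J)))
                   :* ((t :- :1) :* (f :* T)))
              refl (sʲ j) t J L B C Fj T ⟩
        Mn j * (odd j * (L - J) * (t + L + ι (suc j))) * ((t - 1#) * (Fj * T))   ∎))
      where
      J B C T Fj : Carrier
      J = ι j
      B = poch (- L) j
      C = poch t j
      T = poch (t + L) (suc j)
      Fj = poch 1# (suc j)
      den≉0 : Fj * T ≉ 0#
      den≉0 = *-≉0 (poch-1≉0 (suc j)) (poch-avoids≉0 l (suc j) avoids (+≤2*suc (ℕₚ.n≤1+n l) (s≤s j≤l)))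

    τK≈M : ∀ j → j ≤ l → τ t l * K (t + ι 2) l j ≈ M t l j * (odd j * (t + ι j) * (1# + ι j))
    τK≈M j j≤l = begin
      τ t l * K (t + ι 2) l j
        ≈⟨ *-congˡ (K-as-fraction (t + ι 2) l j t+1≉0 den≉0) ⟩
      t * (t + 1#) ÷ Δ * (num ÷ ((t + ι 2 - 1#) * den))
        ≈⟨ ÷-*-÷ Δ≉0 (*-≉0 t+1≉0 den≉0) ⟩
      t * (t + 1#) * num ÷ (Δ * ((t + ι 2 - 1#) * den))
        ≈⟨ M-form j _ (*-≉0 Δ≉0 (*-≉0 t+1≉0 den≉0)) j≤l cross ⟩
      M t l j * (odd j * (t + J) * (1# + J))   ∎
      where
      J B C Y Fj Q Δ num den : Carrier
      J = ι j
      B = poch (- L) j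
      C = poch t j
      Y = poch (t + 1#) j
      Fj = poch 1# j
      Q = poch (t + L + 1# + 1#) j
      Δ = (t + L) * (t + ι (suc l))
      num = sʲ j * (t + ι 2 + ι (2 ℕ.* j) - 1#) * (B * poch (t + ι 2 - 1#) j)
      den = Fj * poch (t + ι 2 + L) j
      Δ≉0 : Δ ≉ 0#
      Δ≉0 = *-≉0 (avoids l (+<2*suc z≤n ℕₚ.≤-refl)) (avoids (suc l) (+<2*suc (s≤s z≤n) ℕₚ.≤-refl))
      t+2-1≈t+1 : t + ι 2 - 1# ≈ t + 1#
      t+2-1≈t+1 = solve 1 (λ t → t :+ con (+ 2) :- :1 := t :+ :1) refl t
      t+1≉0 : t + ι 2 - 1# ≉ 0#
      t+1≉0 = avoids 1 (+<2*suc (s≤s z≤n) z≤n) ∘ trans (trans (+-congˡ (+-identityʳ 1#)) (sym t+2-1≈t+1))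
      shifted : poch (t + ι 2 + L) j ≈ Q
      shifted = poch-cong j (solve 2 (λ t L → t :+ con (+ 2) :+ L := t :+ L :+ :1 :+ :1) refl t L)
      den≉0 : den ≉ 0#
      den≉0 = *-≉0 (poch-1≉0 j) (poch-avoids≉0 (suc (suc l)) j avoids
        (ℕₚ.≤-trans (ℕₚ.≤-reflexive (≡.cong suc (≡.sym (ℕₚ.+-suc l j)))) (+≤2*suc ℕₚ.≤-refl (s≤s j≤l)))
        ∘ trans (poch-cong j (sym (ι-+-assoc t 2 l))))
      cross : t * (t + 1#) * num * Md j ≈ Mn j * (odd j * (t + J) * (1# + J)) * (Δ * ((t + ι 2 - 1#) * den))
      cross = begin
        t * (t + 1#) * (sʲ j * (t + ι 2 + ι (2 ℕ.* j) - 1#) * (B * poch (t + ι 2 - 1#) j))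
          * (Fj * (1# + J) * poch (t + L) (suc (suc j)))
          ≈⟨ *-cong (*-congˡ (*-cong (*-congˡ (+-congʳ (+-congˡ (ι-* 2 j)))) (*-congˡ (poch-cong j t+2-1≈t+1))))
                    (*-congˡ (trans (poch-sucˡ (t + L) (suc j)) (*-congˡ (poch-sucˡ (t + L + 1#) j)))) ⟩
        t * (t + 1#) * (sʲ j * (t + ι 2 + ι 2 * J - 1#) * (B * Y)) * (Fj * (1# + J) * ((t + L) * ((t + L + 1#) * Q)))
          ≈⟨ solve 8 (λ t z J L B Y f Q →
                 t :* (t :+ :1) :* (z :* (t :+ con (+ 2) :+ con (+ 2) :* J :- :1) :* (B :* Y))
                   :* (f :* (:1 :+ J) :* ((t :+ L) :* ((t :+ L :+ :1) :* Q)))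
              := (t :+ :1) :* z :* (t :+ con (+ 2) :+ con (+ 2) :* J :- :1) :* B :* f :* (:1 :+ J)
                   :* (t :+ L) :* (t :+ L :+ :1) :* Q :* (t :* Y))
              refl t (sʲ j) J L B Y Fj Q ⟩
        (t + 1#) * sʲ j * (t + ι 2 + ι 2 * J - 1#) * B * Fj * (1# + J) * (t + L) * (t + L + 1#) * Q * (t * Y)
          ≈⟨ *-congˡ (sym (poch-sucˡ t j)) ⟩
        (t + 1#) * sʲ j * (t + ι 2 + ι 2 * J - 1#) * B * Fj * (1# + J) * (t + L) * (t + L + 1#) * Q * (C * (t + J))
          ≈⟨ solve 8 (λ t z J L B C f Q →
                 (t :+ :1) :* z :* (t :+ con (+ 2) :+ con (+ 2) :* J :- :1) :* B :* f :* (:1 :+ J)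
                   :* (t :+ L) :* (t :+ L :+ :1) :* Q :* (C :* (t :+ J))
              := z :* B :* C :* ((t :+ con (+ 2) :* J :+ :1) :* (t :+ J) :* (:1 :+ J))
                   :* ((t :+ L) :* (t :+ (:1 :+ L)) :* ((t :+ con (+ 2) :- :1) :* (f :* Q))))
              refl t (sʲ j) J L B C Fj Q ⟩
        Mn j * (odd j * (t + J) * (1# + J)) * (Δ * ((t + ι 2 - 1#) * (Fj * Q)))
          ≈⟨ *-congˡ (*-congˡ (*-congˡ (*-congˡ (sym shifted)))) ⟩
        Mn j * (odd j * (t + J) * (1# + J)) * (Δ * ((t + ι 2 - 1#) * den))   ∎

    K-contiguous : ∀ j → j ≤ l → K t (suc l) (suc j) ≈ K t l (suc j) + τ t l * K (t + ι 2) l j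
    K-contiguous j j≤l = begin
      K t (suc l) (suc j)
        ≈⟨ K-suc-suc≈M j j≤l ⟩
      M t l j * (odd j * (1# + L) * (t + L))
        ≈⟨ *-congˡ (solve 3 (λ t L J →
               (t :+ con (+ 2) :* J :+ :1) :* (:1 :+ L) :* (t :+ L)
            := (t :+ con (+ 2) :* J :+ :1) :* (L :- J) :* (t :+ L :+ (:1 :+ J)) :+ (t :+ con (+ 2) :* J :+ :1) :* (t :+ J) :* (:1 :+ J))
            refl t L (ι j)) ⟩
      M t l j * (odd j * (L - ι j) * (t + L + ι (suc j)) + odd j * (t + ι j) * (1# + ι j))
        ≈⟨ distribˡ _ _ _ ⟩
      M t l j * (odd j * (L - ι j) * (t + L + ι (suc j))) + M t l j * (odd j * (t + ι j) * (1# + ι j))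
        ≈⟨ sym (+-cong (K-suc≈M j j≤l) (τK≈M j j≤l)) ⟩
      K t l (suc j) + τ t l * K (t + ι 2) l j   ∎

    ΣK-contiguous : ∀ (g : ℕ → Carrier) → sumTo (suc l) (λ i → K t (suc l) i * g i)
                        ≈ sumTo l (λ i → K t l i * g i) + τ t l * sumTo l (λ j → K (t + ι 2) l j * g (suc j))
    ΣK-contiguous g = begin
      sumTo (suc l) (λ i → K t (suc l) i * g i)
        ≈⟨ sumTo-sucˡ l _ ⟩
      K t l 0 * g 0 + sumTo l (λ j → K t (suc l) (suc j) * g (suc j))
        ≈⟨ +-congˡ (sumTo-cong l (λ j j≤l → *-congʳ (K-contiguous j j≤l))) ⟩
      K t l 0 * g 0 + sumTo l (λ j → (K t l (suc j) + τ t l * K (t + ι 2) l j) * g (suc j))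
        ≈⟨ +-congˡ (trans (sumTo-cong l (λ j _ → distribute j)) (sumTo-+ l _ _)) ⟩
      K t l 0 * g 0 + (sumTo l (λ j → K t l (suc j) * g (suc j)) + sumTo l (λ j → τ t l * (K (t + ι 2) l j * g (suc j))))
        ≈⟨ sym (+-assoc _ _ _) ⟩
      K t l 0 * g 0 + sumTo l (λ j → K t l (suc j) * g (suc j)) + sumTo l (λ j → τ t l * (K (t + ι 2) l j * g (suc j)))
        ≈⟨ +-cong (sym (sumTo-sucˡ l _)) (sym (sumTo-*ˡ l _ _)) ⟩
      sumTo l (λ i → K t l i * g i) + K t l (suc l) * g (suc l) + τ t l * sumTo l (λ j → K (t + ι 2) l j * g (suc j))
        ≈⟨ +-congʳ (trans (+-congˡ (trans (*-congʳ (K-top t l)) (zeroˡ _))) (+-identityʳ _)) ⟩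
      sumTo l (λ i → K t l i * g i) + τ t l * sumTo l (λ j → K (t + ι 2) l j * g (suc j))   ∎
      where
      distribute : ∀ j → (K t l (suc j) + τ t l * K (t + ι 2) l j) * g (suc j)
                         ≈ K t l (suc j) * g (suc j) + τ t l * (K (t + ι 2) l j * g (suc j))
      distribute j = solve 4 (λ a τ b g → (a :+ τ :* b) :* g := a :* g :+ τ :* (b :* g))
                       refl (K t l (suc j)) (τ t l) (K (t + ι 2) l j) (g (suc j))

    private
      poch-t≉0 : ∀ k → k ≤ 2 ℕ.* suc l → poch t k ≉ 0#
      poch-t≉0 k k≤ = poch-≉0 k (λ m m<k → avoids m (ℕₚ.<-≤-trans m<k k≤))

    R-contiguous : ∀ u (g : ℕ → Carrier) →
      (t + L) * R u t (suc l) g ≈ (u + L) * R u t l g + u * R (u + 1#) (t + ι 2) l (λ j → g (suc j))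
    R-contiguous u g = begin
      (t + L) * (P u t (suc l) * sumTo (suc l) (λ i → K t (suc l) i * g i))
        ≈⟨ sym (*-assoc _ _ _) ⟩
      (t + L) * P u t (suc l) * sumTo (suc l) (λ i → K t (suc l) i * g i)
        ≈⟨ *-cong (P-step-l u t l (poch-t≉0 l l≤) t+l≉0) (ΣK-contiguous g) ⟩
      (u + L) * P u t l * (Σ + τ t l * Σ′)
        ≈⟨ solve 5 (λ a p s τ s′ → a :* p :* (s :+ τ :* s′) := a :* (p :* s) :+ a :* p :* τ :* s′) refl (u + L) (P u t l) Σ (τ t l) Σ′ ⟩
      (u + L) * (P u t l * Σ) + (u + L) * P u t l * τ t l * Σ′
        ≈⟨ +-congˡ (*-congʳ (sym (P-step-u u t l (poch-t≉0 l l≤) T₂≉0 (*-≉0 t+l≉0 t+l+1≉0)))) ⟩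
      (u + L) * R u t l g + u * P (u + 1#) (t + ι 2) l * Σ′
        ≈⟨ +-congˡ (*-assoc _ _ _) ⟩
      (u + L) * R u t l g + u * R (u + 1#) (t + ι 2) l (λ j → g (suc j))   ∎
      where
      Σ Σ′ : Carrier
      Σ = sumTo l (λ i → K t l i * g i)
      Σ′ = sumTo l (λ j → K (t + ι 2) l j * g (suc j))
      l≤ : l ≤ 2 ℕ.* suc l
      l≤ = ℕₚ.<⇒≤ (+<2*suc z≤n ℕₚ.≤-refl)
      t+l≉0 : t + L ≉ 0#
      t+l≉0 = avoids l (+<2*suc z≤n ℕₚ.≤-refl)
      t+l+1≉0 : t + ι (suc l) ≉ 0#
      t+l+1≉0 = avoids (suc l) (+<2*suc (s≤s z≤n) ℕₚ.≤-refl)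
      T₂≉0 : poch (t + ι 2) l ≉ 0#
      T₂≉0 = poch-avoids≉0 2 l avoids (ℕₚ.≤-trans (ℕₚ.≤-reflexive (ℕₚ.+-comm 1 (suc l))) (+≤2*suc ℕₚ.≤-refl (s≤s z≤n)))

module Transformation {c ℓ} (F : CharZeroField c ℓ) where
  open CharZeroField F
  open FieldOps F
  open IntegerSolver F
  open FieldFacts F
  open Pochhammer F
  open Sums F
  open Contiguity F
  open Evaluation F
  open Weights F
  open import Relation.Binary.Reasoning.Setoid setoid

  L : ℕ → ℕ → Carrier → Carrier
  L l n u = ₃F₂ u (1# - ι l - u) n ½ (- ι (3 ℕ.* n)) ¾

  L-contiguous : ∀ l n u t → t ≈ ι 2 * u → (t + ι l) * L (suc l) n u ≈ (u + ι l) * L l n u + u * L l n (u + 1#)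
  L-contiguous l n u t t≈2u = begin
    (t + ι l) * ₃F₂ u b n ½ e ¾                                   ≈⟨ *-congʳ t+l≈u-b ⟩
    (u - b) * ₃F₂ u b n ½ e ¾                                     ≈⟨ ₃F₂-contiguous u b n ½ e ¾ ⟩
    u * ₃F₂ (u + 1#) b n ½ e ¾ + (- b) * ₃F₂ u (b + 1#) n ½ e ¾   ≈⟨ +-comm _ _ ⟩
    (- b) * ₃F₂ u (b + 1#) n ½ e ¾ + u * ₃F₂ (u + 1#) b n ½ e ¾
      ≈⟨ +-cong (*-cong -b≈u+l (₃F₂-cong n ½ e ¾ refl b+1≈)) (*-congˡ (₃F₂-cong n ½ e ¾ refl b≈)) ⟩
    (u + ι l) * L l n u + u * L l n (u + 1#)   ∎
    where
    b e : Carrier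
    b = 1# - ι (suc l) - u
    e = - ι (3 ℕ.* n)
    t+l≈u-b : t + ι l ≈ u - b
    t+l≈u-b = trans (+-congʳ t≈2u) (solve 2 (λ u l → con (+ 2) :* u :+ l := u :- (:1 :- (:1 :+ l) :- u)) refl u (ι l))
    -b≈u+l : - b ≈ u + ι l
    -b≈u+l = solve 2 (λ u l → :- (:1 :- (:1 :+ l) :- u) := u :+ l) refl u (ι l)
    b+1≈ : b + 1# ≈ 1# - ι l - u
    b+1≈ = solve 2 (λ u l → :1 :- (:1 :+ l) :- u :+ :1 := :1 :- l :- u) refl u (ι l)
    b≈ : b ≈ 1# - ι l - (u + 1#)
    b≈ = solve 2 (λ u l → :1 :- (:1 :+ l) :- u := :1 :- l :- (u :+ :1)) refl u (ι l)

  L≈R : ∀ l n u t → t ≈ ι 2 * u → t - 1# ≉ 0# → Avoids t (2 ℕ.* l) → L l n u ≈ R u t l (λ i → G n (u + ι i))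
  L≈R zero n u t _ t-1≉0 _ = begin
    L 0 n u
      ≈⟨ ₃F₂-cong n ½ _ ¾ refl (solve 1 (λ u → :1 :- con (+ 0) :- u := :1 :- u) refl u) ⟩
    S n u
      ≈⟨ S≈G n u ⟩
    G n u
      ≈⟨ G-cong n (sym (+-identityʳ u)) ⟩
    G n (u + ι 0)
      ≈⟨ sym (trans (*-cong (P-zero u t) (*-congʳ (K-zero t 0 t-1≉0))) (trans (*-identityˡ _) (*-identityˡ _))) ⟩
    R u t 0 (λ i → G n (u + ι i))   ∎
  L≈R (suc l) n u t t≈2u t-1≉0 avoids = *-cancelˡ (avoids l (+<2*suc z≤n ℕₚ.≤-refl)) (begin
    (t + ι l) * L (suc l) n u
      ≈⟨ L-contiguous l n u t t≈2u ⟩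
    (u + ι l) * L l n u + u * L l n (u + 1#)
      ≈⟨ +-cong (*-congˡ (L≈R l n u t t≈2u t-1≉0 avoids-l)) (*-congˡ shifted) ⟩
    (u + ι l) * R u t l g + u * R (u + 1#) (t + ι 2) l (λ j → g (suc j))
      ≈⟨ sym (R-contiguous t-1≉0 avoids u g) ⟩
    (t + ι l) * R u t (suc l) g   ∎)
    where
    g : ℕ → Carrier
    g i = G n (u + ι i)
    avoids-l : Avoids t (2 ℕ.* l)
    avoids-l m m<2l = avoids m (ℕₚ.<-≤-trans m<2l (ℕₚ.*-monoʳ-≤ 2 (ℕₚ.n≤1+n l)))
    shifted : L l n (u + 1#) ≈ R (u + 1#) (t + ι 2) l (λ j → g (suc j))
    shifted = begin
      L l n (u + 1#)
        ≈⟨ L≈R l n (u + 1#) (t + ι 2) t+2≈2[u+1] t+1≉0 avoids-shifted ⟩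
      R (u + 1#) (t + ι 2) l (λ j → G n (u + 1# + ι j))
        ≈⟨ *-congˡ (sumTo-cong l (λ j _ → *-congˡ (G-cong n (+-assoc u 1# (ι j))))) ⟩
      R (u + 1#) (t + ι 2) l (λ j → g (suc j))   ∎
      where
      t+2≈2[u+1] : t + ι 2 ≈ ι 2 * (u + 1#)
      t+2≈2[u+1] = trans (+-congʳ t≈2u) (solve 1 (λ u → con (+ 2) :* u :+ con (+ 2) := con (+ 2) :* (u :+ :1)) refl u)
      t+1≉0 : t + ι 2 - 1# ≉ 0#
      t+1≉0 = avoids 1 (+<2*suc (s≤s z≤n) z≤n) ∘ trans (solve 1 (λ t → t :+ con (+ 1) := t :+ con (+ 2) :- :1) refl t)
      avoids-shifted : Avoids (t + ι 2) (2 ℕ.* l)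
      avoids-shifted m m<2l = avoids (2 ℕ.+ m) (ℕₚ.≤-trans (s≤s (s≤s m<2l)) (ℕₚ.≤-reflexive (≡.sym (ℕₚ.*-suc 2 l))))
                            ∘ trans (sym (ι-+-assoc t 2 m))

  poch≉0⇒avoids : ∀ t l → poch t l ≉ 0# → poch (t + ι l) l ≉ 0# → Avoids t (2 ℕ.* l)
  poch≉0⇒avoids t zero    _ _ m ()
  poch≉0⇒avoids t (suc l) Tₗ≉0 T′≉0 m m<2l t+m≈0 with m ℕₚ.<? suc l
  ... | yes m<l = Tₗ≉0 (poch-≈0 (suc l) m<l t+m≈0)
  ... | no m≮l  = T′≉0 (poch-≈0 (suc l) m∸l<l (trans t+l+[m∸l]≈t+m t+m≈0))
    where
    t+l+[m∸l]≈t+m : t + ι (suc l) + ι (m ℕ.∸ suc l) ≈ t + ι m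
    t+l+[m∸l]≈t+m = trans (ι-+-assoc t (suc l) _) (reflexive (≡.cong (λ k → t + ι k) (ℕₚ.m+[n∸m]≡n (ℕₚ.≮⇒≥ m≮l))))
    m∸l<l : m ℕ.∸ suc l < suc l
    m∸l<l = ℕₚ.m<n+o⇒m∸n<o m (suc l) (ℕₚ.<-≤-trans m<2l (ℕₚ.≤-reflexive (≡.cong (suc l ℕ.+_) (ℕₚ.+-identityʳ (suc l)))))

  G-at-3x+i : ∀ n x i → G n (ι 3 * x + ι i)
    ≈ poch (ι (1 ℕ.+ i) ÷ ι 3 + x) n * poch ((ι 2 - ι i) ÷ ι 3 - x) n ÷ (poch (1# ÷ ι 3) n * poch (ι 2 ÷ ι 3) n)
  G-at-3x+i n x i = *-congʳ (*-cong (poch-cong n α≈) (poch-cong n β≈))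
    where
    α≈ : (ι 3 * x + ι i + 1#) ÷ ι 3 ≈ ι (1 ℕ.+ i) ÷ ι 3 + x
    α≈ = trans (÷-cong (solve 2 (λ x i → con (+ 3) :* x :+ i :+ :1 := :1 :+ i :+ con (+ 3) :* x) refl x (ι i)) refl) (+-*-÷ _ x 3≉0)
    β≈ : (ι 2 - (ι 3 * x + ι i)) ÷ ι 3 ≈ (ι 2 - ι i) ÷ ι 3 - x
    β≈ = trans (÷-cong (solve 2 (λ x i →
           con (+ 2) :- (con (+ 3) :* x :+ i)
        := con (+ 2) :- i :+ con (+ 3) :* (:- x))
        refl x (ι i)) refl) (+-*-÷ _ (- x) 3≉0)

proposition3 : ∀ {c ℓ} (F : CharZeroField c ℓ) →
  let open CharZeroField F
      open FieldOps F
  in ∀ (l n : ℕ) (x : Carrier) →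
     -- the x-dependent denominators do not vanish
     ¬ (poch (ι 6 * x) l ≈ 0#) →
     ¬ (ι 6 * x - 1# ≈ 0#) →
     (∀ i → i ≤ l → ¬ (poch (ι 6 * x + ι l) i ≈ 0#)) →
     ₃F₂ (ι 3 * x) (1# - ι l - ι 3 * x) n (1# ÷ ι 2) (- ι (3 Data.Nat.* n)) (ι 3 ÷ ι 4)
     ≈ poch (ι 3 * x) l ÷ poch (ι 6 * x) l
       * sumTo l (λ i →
           pow (- 1#) i
           * ((ι 6 * x + ι (2 Data.Nat.* i) - 1#) ÷ (ι 6 * x - 1#))
           * ((poch (- ι l) i * poch (ι 6 * x - 1#) i)
              ÷ (poch 1# i * poch (ι 6 * x + ι l) i))
           * ((poch (ι (1 Data.Nat.+ i) ÷ ι 3 + x) n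
               * poch ((ι 2 - ι i) ÷ ι 3 - x) n)
              ÷ (poch (1# ÷ ι 3) n * poch (ι 2 ÷ ι 3) n)))
proposition3 F l n x 6x⟨l⟩≉0 6x-1≉0 6x+l⟨i⟩≉0 =
  trans (L≈R l n (ι 3 * x) (ι 6 * x) 6x≈2·3x 6x-1≉0 (poch≉0⇒avoids (ι 6 * x) l 6x⟨l⟩≉0 (6x+l⟨i⟩≉0 l ℕₚ.≤-refl)))
        (*-congˡ (sumTo-cong l (λ i _ → *-congˡ (G-at-3x+i n x i))))
  where
  open CharZeroField F
  open IntegerSolver F
  open Sums F
  open Transformation F
  6x≈2·3x : ι 6 * x ≈ ι 2 * (ι 3 * x)
  6x≈2·3x = solve 1 (λ x → con (+ 6) :* x := con (+ 2) :* (con (+ 3) :* x)) refl x
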